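{- Let $n=p^mq^m$, where $p,q$ are distinct primes and $m>1$ is an integer, and put $k=m^2+m-2$. Then the adjacency spectrum of the essential ideal graph $\mathcal{E}_{\mathbb{Z}_n}$ consists of: $\frac{k+\sqrt{k^2+4m^3}}{2}$ with multiplicity $1$; $0$ with multiplicity $2m-2$; $-1$ with multiplicity $m^2-2$; $\frac{k-\sqrt{k^2+4m^3}}{2}$ with multiplicity $1$; and $-m$ with multiplicity $1$.
   Context: $\mathbb{Z}_n$ is the ring of integers modulo $n$. An ideal $I$ of a commutative ring $R$ is essential if $I\cap J\neq\{0\}$ for every nonzero ideal $J$ of $R$. The essential ideal graph $\mathcal{E}_{\mathbb{Z}_n}$ is the simple graph whose vertex set is the set of all nonzero proper ideals of $\mathbb{Z}_n$, two distinct vertices $I,K$ being adjacent if and only if $I+K$ is an essential ideal of $\mathbb{Z}_n$. The (adjacency) spectrum of a graph is the multiset of eigenvalues of its adjacency matrix. -}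

module Defs where

open import Data.Nat as ℕ using (ℕ; zero; suc; _<_)
open import Data.Nat.Divisibility using (_∣_)
open import Data.Integer as ℤ using (ℤ; +_; -_)
open import Data.Fin using (Fin; zero; suc; punchIn; _≟_)
open import Data.Product using (Σ; _×_; _,_; ∃; ∃-syntax)
import Data.Fin
open import Relation.Nullary using (¬_; yes; no)
open import Relation.Binary.PropositionalEquality using (_≡_; _≢_)

-- Elements of ℤ_n are represented by naturals x < n.
-- Every ideal of ℤ_n is principal, generated by a divisor d of n:
--   ⟨d⟩ = { x < n ∣ d ∣ x }.

Ideal : ℕ → Set
Ideal n = Σ ℕ (λ d → d ∣ n)

gen : ∀ {n} → Ideal n → ℕ
gen (d , _) = d

_∈⟨_⟩ : ℕ → ℕ → Set
x ∈⟨ d ⟩ = d ∣ x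

NonzeroIdeal : (n : ℕ) → Ideal n → Set
NonzeroIdeal n I = ∃[ x ] (0 < x × x < n × x ∈⟨ gen I ⟩)

ProperIdeal : (n : ℕ) → Ideal n → Set
ProperIdeal n I = ∃[ x ] (x < n × ¬ (x ∈⟨ gen I ⟩))

InSum : (n : ℕ) → Ideal n → Ideal n → ℕ → Set
InSum n I K x =
  x < n × ∃[ a ] ∃[ b ] ∃[ t ]
    (a < n × b < n × a ∈⟨ gen I ⟩ × b ∈⟨ gen K ⟩ × a ℕ.+ b ≡ x ℕ.+ t ℕ.* n)

SumEssential : (n : ℕ) → Ideal n → Ideal n → Set
SumEssential n I K =
  (J : Ideal n) → NonzeroIdeal n J →
  ∃[ x ] (0 < x × InSum n I K x × x ∈⟨ gen J ⟩)

record VertexEnum (n N : ℕ) : Set where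
  field
    vtx       : Fin N → Ideal n
    injective : ∀ i j → gen (vtx i) ≡ gen (vtx j) → i ≡ j
    nonzero   : ∀ i → NonzeroIdeal n (vtx i)
    proper    : ∀ i → ProperIdeal n (vtx i)
    complete  : (I : Ideal n) → NonzeroIdeal n I → ProperIdeal n I →
                ∃[ i ] (gen (vtx i) ≡ gen I)

IsAdjacencyMatrix : (n N : ℕ) → VertexEnum n N → (Fin N → Fin N → ℤ) → Set
IsAdjacencyMatrix n N E A =
  ∀ i j → (i ≡ j → A i j ≡ + 0)
        × (i ≢ j → SumEssential n (VertexEnum.vtx E i) (VertexEnum.vtx E j) → A i j ≡ + 1)
        × (i ≢ j → ¬ SumEssential n (VertexEnum.vtx E i) (VertexEnum.vtx E j) → A i j ≡ + 0)

Matrix : ℕ → Set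
Matrix N = Fin N → Fin N → ℤ

minor : ∀ {N} → Matrix (suc N) → Fin (suc N) → Matrix N
minor M j r c = M (suc r) (punchIn j c)

sumFin : ∀ N → (Fin N → ℤ) → ℤ
sumFin zero    f = + 0
sumFin (suc N) f = f zero ℤ.+ sumFin N (λ i → f (suc i))

sign : ℕ → ℤ
sign zero          = + 1
sign (suc zero)    = - + 1
sign (suc (suc k)) = sign k

det : ∀ N → Matrix N → ℤ
det zero    M = + 1
det (suc N) M =
  sumFin (suc N) (λ j → sign (Data.Fin.toℕ j) ℤ.* M zero j ℤ.* det N (minor M j))

charPolyAt : ∀ N → Matrix N → ℤ → ℤ
charPolyAt N A x = det N (λ i j → diag i j ℤ.- A i j)
  where
  diag : Fin N → Fin N → ℤ
  diag i j with i ≟ j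
  ... | yes _ = x
  ... | no  _ = + 0

module Submission where

open import Defs
open import Data.Nat as ℕ using (ℕ; _<_)
open import Data.Nat.Primality using (Prime)
open import Data.Integer as ℤ using (ℤ; +_)
open import Relation.Binary.PropositionalEquality using (_≡_; _≢_)
open import Data.Nat using (zero; suc)

-- The nonzero proper ideals of ℤ_n are the ⟨p^a q^b⟩ with a, b ≤ m and (a, b) other than (0, 0)
-- and (m, m).  Every nonzero ideal contains ⟨n/p⟩ or ⟨n/q⟩, so I + K is essential unless p^m
-- divides both generators or q^m does.  Sorting the vertices into the classes a = m (m vertices),
-- b = m (m vertices) and the remaining m² − 1, the matrix x I − A is D − B with D diagonal and B
-- depending only on the classes of row and column.  Expanding det (D − B) row by row, by
-- multilinearity, gives a sum over sets T of classes of the principal minor of −B on T times powers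
-- of the diagonal entries; two rows of −B from one class coincide, so each class gives at most one
-- row to the minor.  For the class sizes above the eight terms factor as
-- x^(2m−2) (x + 1)^(m²−2) (x + m) (x² − k x − m³).

module Determinant where

  open import Data.Integer using (_+_; _*_; -_; -1ℤ; 0ℤ; 1ℤ; +[1+_]; -[1+_])
  open import Data.Integer.Properties as ℤᵖ
    using (*-zeroʳ; *-zeroˡ; *-identityˡ; +-identityˡ; +-identityʳ; neg-involutive; -1*i≡-i)
  open import Data.Integer.Tactic.RingSolver using (solve-∀)
  open import Algebra.Properties.Semiring.Sum ℤᵖ.+-*-semiring
    using (sum; sum-cong-≗; sum-remove; ∑-distrib-+; *-distribˡ-sum; sum-replicate-zero)
  open import Data.Empty using (⊥-elim)
  open import Data.Fin using (Fin; zero; suc; punchIn; pinch; toℕ)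
  open import Data.Fin.Properties using (suc-injective; punchInᵢ≢i; punchIn-injective)
  open import Function using (_∘_)
  open import Relation.Binary.PropositionalEquality
  open ≡-Reasoning

  sumFin≡sum : ∀ N (f : Fin N → ℤ) → sumFin N f ≡ sum f
  sumFin≡sum zero    f = refl
  sumFin≡sum (suc N) f = cong (_+_ (f zero)) (sumFin≡sum N (f ∘ suc))

  sumFin-cong : ∀ N {f g : Fin N → ℤ} → (∀ j → f j ≡ g j) → sumFin N f ≡ sumFin N g
  sumFin-cong N {f} {g} f≗g = begin
    sumFin N f  ≡⟨ sumFin≡sum N f ⟩
    sum f       ≡⟨ sum-cong-≗ f≗g ⟩
    sum g       ≡⟨ sumFin≡sum N g ⟨
    sumFin N g  ∎

  sumFin-zero : ∀ N {f : Fin N → ℤ} → (∀ j → f j ≡ 0ℤ) → sumFin N f ≡ 0ℤ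
  sumFin-zero N f≗0 = trans (sumFin-cong N f≗0) (trans (sumFin≡sum N _) (sum-replicate-zero N))

  sumFin-+ : ∀ N (f g : Fin N → ℤ) → sumFin N (λ j → f j + g j) ≡ sumFin N f + sumFin N g
  sumFin-+ N f g = begin
    sumFin N (λ j → f j + g j)   ≡⟨ sumFin≡sum N _ ⟩
    sum (λ j → f j + g j)        ≡⟨ ∑-distrib-+ f g ⟩
    sum f + sum g                ≡⟨ cong₂ _+_ (sumFin≡sum N f) (sumFin≡sum N g) ⟨
    sumFin N f + sumFin N g      ∎

  sumFin-scale : ∀ N (a : ℤ) (f : Fin N → ℤ) → sumFin N (λ j → a * f j) ≡ a * sumFin N f
  sumFin-scale N a f = begin
    sumFin N (λ j → a * f j)   ≡⟨ sumFin≡sum N _ ⟩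
    sum (λ j → a * f j)        ≡⟨ *-distribˡ-sum a f ⟨
    a * sum f                  ≡⟨ cong (a *_) (sumFin≡sum N f) ⟨
    a * sumFin N f             ∎

  sumFin-neg : ∀ N (f : Fin N → ℤ) → sumFin N (λ j → - f j) ≡ - sumFin N f
  sumFin-neg N f = begin
    sumFin N (λ j → - f j)     ≡⟨ sumFin-cong N (λ j → sym (-1*i≡-i (f j))) ⟩
    sumFin N (λ j → -1ℤ * f j) ≡⟨ sumFin-scale N -1ℤ f ⟩
    -1ℤ * sumFin N f           ≡⟨ -1*i≡-i (sumFin N f) ⟩
    - sumFin N f               ∎

  sumFin-punchIn : ∀ N (f : Fin (suc N) → ℤ) k → sumFin (suc N) f ≡ f k + sumFin N (f ∘ punchIn k)
  sumFin-punchIn N f k = begin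
    sumFin (suc N) f              ≡⟨ sumFin≡sum (suc N) f ⟩
    sum f                         ≡⟨ sum-remove f ⟩
    f k + sum (f ∘ punchIn k)     ≡⟨ cong (_+_ (f k)) (sumFin≡sum N _) ⟨
    f k + sumFin N (f ∘ punchIn k) ∎

  sumFin-δ : ∀ N (f : Fin (suc N) → ℤ) k → (∀ j → j ≢ k → f j ≡ 0ℤ) → sumFin (suc N) f ≡ f k
  sumFin-δ N f k f≗0 = begin
    sumFin (suc N) f                ≡⟨ sumFin-punchIn N f k ⟩
    f k + sumFin N (f ∘ punchIn k)  ≡⟨ cong (_+_ (f k)) (sumFin-zero N (λ j → f≗0 _ (punchInᵢ≢i k j))) ⟩
    f k + 0ℤ                        ≡⟨ +-identityʳ (f k) ⟩
    f k                             ∎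

  -- (j , k) ↦ (punchIn j k , pinch k j) is an involution of the pairs of distinct indices.
  sumFin-swap-pairs : ∀ n (g : Fin (suc n) → Fin n → ℤ) →
    sumFin (suc n) (λ j → sumFin n (λ k → g (punchIn j k) (pinch k j)))
    ≡ sumFin (suc n) (λ j → sumFin n (g j))
  sumFin-swap-pairs zero    g = refl
  sumFin-swap-pairs (suc n) g = begin
    column₀ + sumFin (suc n) (λ j → g zero j + swapped j)  ≡⟨ cong (_+_ column₀) (sumFin-+ (suc n) (g zero) swapped) ⟩
    column₀ + (row₀ + sumFin (suc n) swapped)
      ≡⟨ cong (λ s → column₀ + (row₀ + s)) (sumFin-swap-pairs n (λ a b → g (suc a) (suc b))) ⟩
    column₀ + (row₀ + rest)                                ≡⟨ regroup column₀ row₀ rest ⟩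
    row₀ + (column₀ + rest)
      ≡⟨ cong (_+_ row₀) (sumFin-+ (suc n) (λ j → g (suc j) zero) (λ j → sumFin n (λ k → g (suc j) (suc k)))) ⟨
    row₀ + sumFin (suc n) (λ j → g (suc j) zero + sumFin n (λ k → g (suc j) (suc k))) ∎
    where
    column₀ row₀ rest : ℤ
    column₀ = sumFin (suc n) (λ k → g (suc k) zero)
    row₀ = sumFin (suc n) (g zero)
    rest = sumFin (suc n) (λ j → sumFin n (λ k → g (suc j) (suc k)))
    swapped : Fin (suc n) → ℤ
    swapped j = sumFin n (λ k → g (suc (punchIn j k)) (suc (pinch k j)))
    regroup : ∀ a b c → a + (b + c) ≡ b + (a + c)
    regroup = solve-∀

  laplaceTerm : ∀ N → Matrix (suc N) → Fin (suc N) → ℤ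
  laplaceTerm N M j = sign (toℕ j) * M zero j * det N (minor M j)

  det-cong : ∀ N {M M′ : Matrix N} → (∀ i j → M i j ≡ M′ i j) → det N M ≡ det N M′
  det-cong zero    _    = refl
  det-cong (suc N) M≗M′ = sumFin-cong (suc N) λ j →
    cong₂ (λ a d → sign (toℕ j) * a * d) (M≗M′ zero j) (det-cong N (λ r c → M≗M′ (suc r) (punchIn j c)))

  laplaceTerm-entry≡0 : ∀ N (M : Matrix (suc N)) j → M zero j ≡ 0ℤ → laplaceTerm N M j ≡ 0ℤ
  laplaceTerm-entry≡0 N M j M₀ⱼ≡0 = begin
    sign (toℕ j) * M zero j * det N (minor M j)  ≡⟨ cong (λ a → sign (toℕ j) * a * det N (minor M j)) M₀ⱼ≡0 ⟩
    sign (toℕ j) * 0ℤ * det N (minor M j)        ≡⟨ cong (_* det N (minor M j)) (*-zeroʳ (sign (toℕ j))) ⟩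
    0ℤ * det N (minor M j)                       ≡⟨ *-zeroˡ (det N (minor M j)) ⟩
    0ℤ                                           ∎

  laplaceTerm-minor≡0 : ∀ N (M : Matrix (suc N)) j → det N (minor M j) ≡ 0ℤ → laplaceTerm N M j ≡ 0ℤ
  laplaceTerm-minor≡0 N M j minor≡0 = trans (cong (sign (toℕ j) * M zero j *_) minor≡0) (*-zeroʳ (sign (toℕ j) * M zero j))

  det-zero-row : ∀ N (M : Matrix N) r → (∀ c → M r c ≡ 0ℤ) → det N M ≡ 0ℤ
  det-zero-row (suc N) M zero    row≗0 = sumFin-zero (suc N) λ j → laplaceTerm-entry≡0 N M j (row≗0 j)
  det-zero-row (suc N) M (suc r) row≗0 = sumFin-zero (suc N) λ j →
    laplaceTerm-minor≡0 N M j (det-zero-row N (minor M j) r (row≗0 ∘ punchIn j))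

  det-linear-termwise : ∀ N (M U V : Matrix (suc N)) (a : ℤ) →
    (∀ j → laplaceTerm N M j ≡ a * laplaceTerm N U j + laplaceTerm N V j) →
    det (suc N) M ≡ a * det (suc N) U + det (suc N) V
  det-linear-termwise N M U V a terms = begin
    sumFin (suc N) (laplaceTerm N M)                                          ≡⟨ sumFin-cong (suc N) terms ⟩
    sumFin (suc N) (λ j → a * laplaceTerm N U j + laplaceTerm N V j)
      ≡⟨ sumFin-+ (suc N) (λ j → a * laplaceTerm N U j) (laplaceTerm N V) ⟩
    sumFin (suc N) (λ j → a * laplaceTerm N U j) + sumFin (suc N) (laplaceTerm N V)
      ≡⟨ cong (_+ sumFin (suc N) (laplaceTerm N V)) (sumFin-scale (suc N) a (laplaceTerm N U)) ⟩
    a * det (suc N) U + det (suc N) V                                         ∎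

  det-linear-row : ∀ N (M U V : Matrix N) r (a : ℤ) →
    (∀ c → M r c ≡ a * U r c + V r c) →
    (∀ i → i ≢ r → ∀ c → M i c ≡ U i c) →
    (∀ i → i ≢ r → ∀ c → M i c ≡ V i c) →
    det N M ≡ a * det N U + det N V
  det-linear-row (suc N) M U V zero a row U-rest V-rest = det-linear-termwise N M U V a λ j →
    let s = sign (toℕ j)
        D = det N (minor M j)
    in begin
    s * M zero j * D                                ≡⟨ cong (λ x → s * x * D) (row j) ⟩
    s * (a * U zero j + V zero j) * D               ≡⟨ distribute s a (U zero j) (V zero j) D ⟩
    a * (s * U zero j * D) + s * V zero j * D
      ≡⟨ cong₂ (λ d d′ → a * (s * U zero j * d) + s * V zero j * d′)
               (det-cong N (λ r c → U-rest (suc r) (λ ()) (punchIn j c)))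
               (det-cong N (λ r c → V-rest (suc r) (λ ()) (punchIn j c))) ⟩
    a * laplaceTerm N U j + laplaceTerm N V j       ∎
    where
    distribute : ∀ s a u v d → s * (a * u + v) * d ≡ a * (s * u * d) + s * v * d
    distribute = solve-∀
  det-linear-row (suc N) M U V (suc r) a row U-rest V-rest = det-linear-termwise N M U V a λ j →
    let s = sign (toℕ j)
    in begin
    s * M zero j * det N (minor M j)
      ≡⟨ cong (s * M zero j *_) (det-linear-row N (minor M j) (minor U j) (minor V j) r a (row ∘ punchIn j)
                (λ i i≢r c → U-rest (suc i) (i≢r ∘ suc-injective) (punchIn j c))
                (λ i i≢r c → V-rest (suc i) (i≢r ∘ suc-injective) (punchIn j c))) ⟩
    s * M zero j * (a * det N (minor U j) + det N (minor V j))
      ≡⟨ distribute s (M zero j) a (det N (minor U j)) (det N (minor V j)) ⟩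
    a * (s * M zero j * det N (minor U j)) + s * M zero j * det N (minor V j)
      ≡⟨ cong₂ (λ u v → a * (s * u * det N (minor U j)) + s * v * det N (minor V j))
               (U-rest zero (λ ()) j) (V-rest zero (λ ()) j) ⟩
    a * laplaceTerm N U j + laplaceTerm N V j       ∎
    where
    distribute : ∀ s m a u v → s * m * (a * u + v) ≡ a * (s * m * u) + s * m * v
    distribute = solve-∀

  sign-suc : ∀ n → sign (suc n) ≡ - sign n
  sign-suc zero          = refl
  sign-suc (suc zero)    = refl
  sign-suc (suc (suc n)) = sign-suc n

  sign-+ : ∀ m n → sign (m ℕ.+ n) ≡ sign m * sign n
  sign-+ zero          n = sym (*-identityˡ (sign n))
  sign-+ (suc zero)    n = trans (sign-suc n) (sym (-1*i≡-i (sign n)))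
  sign-+ (suc (suc m)) n = sign-+ m n

  sign-double : ∀ n → sign (n ℕ.+ n) ≡ 1ℤ
  sign-double n = trans (sign-+ n n) (square n)
    where
    square : ∀ n → sign n * sign n ≡ 1ℤ
    square zero          = refl
    square (suc zero)    = refl
    square (suc (suc n)) = square n

  punchIn-pinch : ∀ {n} (k : Fin (suc n)) (j : Fin n) → punchIn (punchIn k j) (pinch j k) ≡ k
  punchIn-pinch zero    zero    = refl
  punchIn-pinch zero    (suc j) = refl
  punchIn-pinch (suc k) zero    = refl
  punchIn-pinch (suc k) (suc j) = cong suc (punchIn-pinch k j)

  punchIn-punchIn-pinch : ∀ {n} (k : Fin (suc (suc n))) (j : Fin (suc n)) (b : Fin n) →
                          punchIn (punchIn k j) (punchIn (pinch j k) b) ≡ punchIn k (punchIn j b)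
  punchIn-punchIn-pinch zero    zero    b       = refl
  punchIn-punchIn-pinch zero    (suc j) b       = refl
  punchIn-punchIn-pinch (suc k) zero    b       = refl
  punchIn-punchIn-pinch (suc k) (suc j) zero    = refl
  punchIn-punchIn-pinch (suc k) (suc j) (suc b) = cong suc (punchIn-punchIn-pinch k j b)

  sign-punchIn-pinch : ∀ {n} (k : Fin (suc n)) (j : Fin n) →
    sign (toℕ (punchIn k j)) * sign (toℕ (pinch j k)) ≡ - (sign (toℕ k) * sign (toℕ j))
  sign-punchIn-pinch zero    zero    = refl
  sign-punchIn-pinch zero    (suc j) = begin
    sign (toℕ j) * 1ℤ              ≡⟨ rearrange (sign (toℕ j)) ⟩
    - (1ℤ * - sign (toℕ j))        ≡⟨ cong (λ u → - (1ℤ * u)) (sign-suc (toℕ j)) ⟨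
    - (1ℤ * sign (suc (toℕ j)))    ∎
    where
    rearrange : ∀ s → s * 1ℤ ≡ - (1ℤ * - s)
    rearrange = solve-∀
  sign-punchIn-pinch (suc k) zero    = begin
    1ℤ * sign (toℕ k)              ≡⟨ rearrange (sign (toℕ k)) ⟩
    - (- sign (toℕ k) * 1ℤ)        ≡⟨ cong (λ u → - (u * 1ℤ)) (sign-suc (toℕ k)) ⟨
    - (sign (suc (toℕ k)) * 1ℤ)    ∎
    where
    rearrange : ∀ s → 1ℤ * s ≡ - (- s * 1ℤ)
    rearrange = solve-∀
  sign-punchIn-pinch (suc k) (suc j) = begin
    sign (suc (toℕ (punchIn k j))) * sign (suc (toℕ (pinch j k)))
      ≡⟨ cong₂ _*_ (sign-suc (toℕ (punchIn k j))) (sign-suc (toℕ (pinch j k))) ⟩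
    - sign (toℕ (punchIn k j)) * - sign (toℕ (pinch j k))
      ≡⟨ neg*neg (sign (toℕ (punchIn k j))) (sign (toℕ (pinch j k))) ⟩
    sign (toℕ (punchIn k j)) * sign (toℕ (pinch j k))
      ≡⟨ sign-punchIn-pinch k j ⟩
    - (sign (toℕ k) * sign (toℕ j))
      ≡⟨ cong -_ (neg*neg (sign (toℕ k)) (sign (toℕ j))) ⟨
    - (- sign (toℕ k) * - sign (toℕ j))
      ≡⟨ cong₂ (λ a b → - (a * b)) (sign-suc (toℕ k)) (sign-suc (toℕ j)) ⟨
    - (sign (suc (toℕ k)) * sign (suc (toℕ j))) ∎
    where
    neg*neg : ∀ a b → - a * - b ≡ a * b
    neg*neg = solve-∀

  sign-punchIn-+-pinch : ∀ {n} r (k : Fin (suc n)) (j : Fin n) →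
    sign (toℕ (punchIn k j)) * sign (r ℕ.+ toℕ (pinch j k)) ≡ sign (suc (r ℕ.+ toℕ k)) * sign (toℕ j)
  sign-punchIn-+-pinch r k j = begin
    sign (toℕ (punchIn k j)) * sign (r ℕ.+ toℕ (pinch j k))
      ≡⟨ cong (sign (toℕ (punchIn k j)) *_) (sign-+ r (toℕ (pinch j k))) ⟩
    sign (toℕ (punchIn k j)) * (sign r * sign (toℕ (pinch j k)))
      ≡⟨ rotate (sign (toℕ (punchIn k j))) (sign r) (sign (toℕ (pinch j k))) ⟩
    sign r * (sign (toℕ (punchIn k j)) * sign (toℕ (pinch j k)))
      ≡⟨ cong (sign r *_) (sign-punchIn-pinch k j) ⟩
    sign r * - (sign (toℕ k) * sign (toℕ j))
      ≡⟨ regroup (sign r) (sign (toℕ k)) (sign (toℕ j)) ⟩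
    - (sign r * sign (toℕ k)) * sign (toℕ j)
      ≡⟨ cong (λ s → - s * sign (toℕ j)) (sign-+ r (toℕ k)) ⟨
    - sign (r ℕ.+ toℕ k) * sign (toℕ j)
      ≡⟨ cong (_* sign (toℕ j)) (sign-suc (r ℕ.+ toℕ k)) ⟨
    sign (suc (r ℕ.+ toℕ k)) * sign (toℕ j) ∎
    where
    rotate : ∀ a b c → a * (b * c) ≡ b * (a * c)
    rotate = solve-∀
    regroup : ∀ a b c → a * - (b * c) ≡ - (a * b) * c
    regroup = solve-∀

  remove : ∀ {N} → Fin (suc N) → Fin (suc N) → Matrix (suc N) → Matrix N
  remove r k M i j = M (punchIn r i) (punchIn k j)

  det-unit-row : ∀ N (M : Matrix (suc N)) r k (a : ℤ) → M r k ≡ a → (∀ c → c ≢ k → M r c ≡ 0ℤ) →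
                 det (suc N) M ≡ sign (toℕ r ℕ.+ toℕ k) * a * det N (remove r k M)
  det-unit-row N M zero k a Mrk≡a row≗0 = begin
    det (suc N) M
      ≡⟨ sumFin-δ N (laplaceTerm N M) k (λ j j≢k → laplaceTerm-entry≡0 N M j (row≗0 j j≢k)) ⟩
    sign (toℕ k) * M zero k * det N (minor M k) ≡⟨ cong (λ x → sign (toℕ k) * x * det N (minor M k)) Mrk≡a ⟩
    sign (toℕ k) * a * det N (minor M k)        ∎
  det-unit-row (suc N) M (suc r) k a Mrk≡a row≗0 = begin
    det (suc (suc N)) M                                         ≡⟨ sumFin-punchIn (suc N) (laplaceTerm (suc N) M) k ⟩
    laplaceTerm (suc N) M k + sumFin (suc N) (laplaceTerm (suc N) M ∘ punchIn k)
      ≡⟨ cong₂ _+_ term-k≡0 (sumFin-cong (suc N) term-punchIn) ⟩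
    0ℤ + sumFin (suc N) (λ j → σ * a * laplaceTerm N R j)        ≡⟨ +-identityˡ _ ⟩
    sumFin (suc N) (λ j → σ * a * laplaceTerm N R j)             ≡⟨ sumFin-scale (suc N) (σ * a) (laplaceTerm N R) ⟩
    σ * a * det (suc N) R                                       ∎
    where
    R : Matrix (suc N)
    R = remove (suc r) k M
    σ : ℤ
    σ = sign (suc (toℕ r ℕ.+ toℕ k))
    term-k≡0 : laplaceTerm (suc N) M k ≡ 0ℤ
    term-k≡0 = laplaceTerm-minor≡0 (suc N) M k
                 (det-zero-row (suc N) (minor M k) r (λ c → row≗0 (punchIn k c) (punchInᵢ≢i k c)))
    minor-row : ∀ j → det (suc N) (minor M (punchIn k j))
                      ≡ sign (toℕ r ℕ.+ toℕ (pinch j k)) * a * det N (minor R j)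
    minor-row j = trans
      (det-unit-row N (minor M (punchIn k j)) r (pinch j k) a
         (trans (cong (M (suc r)) (punchIn-pinch k j)) Mrk≡a)
         (λ c c≢ → row≗0 _ λ e → c≢ (punchIn-injective (punchIn k j) c (pinch j k) (trans e (sym (punchIn-pinch k j))))))
      (cong (sign (toℕ r ℕ.+ toℕ (pinch j k)) * a *_)
         (det-cong N (λ x y → cong (M (suc (punchIn r x))) (punchIn-punchIn-pinch k j y))))
    term-punchIn : ∀ j → laplaceTerm (suc N) M (punchIn k j) ≡ σ * a * laplaceTerm N R j
    term-punchIn j = begin
      sign (toℕ (punchIn k j)) * M zero (punchIn k j) * det (suc N) (minor M (punchIn k j))
        ≡⟨ cong (sign (toℕ (punchIn k j)) * M zero (punchIn k j) *_) (minor-row j) ⟩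
      sign (toℕ (punchIn k j)) * M zero (punchIn k j) * (sign (toℕ r ℕ.+ toℕ (pinch j k)) * a * det N (minor R j))
        ≡⟨ regroup (sign (toℕ (punchIn k j))) (sign (toℕ r ℕ.+ toℕ (pinch j k)))
                   (M zero (punchIn k j)) a (det N (minor R j)) ⟩
      sign (toℕ (punchIn k j)) * sign (toℕ r ℕ.+ toℕ (pinch j k)) * a * (M zero (punchIn k j) * det N (minor R j))
        ≡⟨ cong (λ s → s * a * (M zero (punchIn k j) * det N (minor R j))) (sign-punchIn-+-pinch (toℕ r) k j) ⟩
      σ * sign (toℕ j) * a * (M zero (punchIn k j) * det N (minor R j))
        ≡⟨ regroup′ σ (sign (toℕ j)) a (M zero (punchIn k j)) (det N (minor R j)) ⟩
      σ * a * laplaceTerm N R j ∎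
      where
      regroup : ∀ s t m a d → s * m * (t * a * d) ≡ s * t * a * (m * d)
      regroup = solve-∀
      regroup′ : ∀ σ s a m d → σ * s * a * (m * d) ≡ σ * a * (s * m * d)
      regroup′ = solve-∀

  det-unit-diagonal : ∀ N (M : Matrix (suc N)) i → M i i ≡ 1ℤ → (∀ c → c ≢ i → M i c ≡ 0ℤ) →
                      det (suc N) M ≡ det N (remove i i M)
  det-unit-diagonal N M i Mᵢᵢ≡1 row≗0 = begin
    det (suc N) M                                               ≡⟨ det-unit-row N M i i 1ℤ Mᵢᵢ≡1 row≗0 ⟩
    sign (toℕ i ℕ.+ toℕ i) * 1ℤ * det N (remove i i M)
      ≡⟨ cong (λ σ → σ * 1ℤ * det N (remove i i M)) (sign-double (toℕ i)) ⟩
    1ℤ * 1ℤ * det N (remove i i M)                              ≡⟨ *-identityˡ (det N (remove i i M)) ⟩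
    det N (remove i i M)                                        ∎

  laplaceTerm₂ : ∀ N → Matrix (suc (suc N)) → Fin (suc (suc N)) → Fin (suc N) → ℤ
  laplaceTerm₂ N M j k = sign (toℕ j) * M zero j * laplaceTerm N (minor M j) k

  det-expand₂ : ∀ N (M : Matrix (suc (suc N))) →
                det (suc (suc N)) M ≡ sumFin (suc (suc N)) (λ j → sumFin (suc N) (laplaceTerm₂ N M j))
  det-expand₂ N M = sumFin-cong (suc (suc N)) λ j →
    sym (sumFin-scale (suc N) (sign (toℕ j) * M zero j) (laplaceTerm N (minor M j)))

  det-swap₀₁ : ∀ N (M M′ : Matrix (suc (suc N))) →
    (∀ c → M′ zero c ≡ M (suc zero) c) → (∀ c → M′ (suc zero) c ≡ M zero c) →
    (∀ i c → M′ (suc (suc i)) c ≡ M (suc (suc i)) c) →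
    det (suc (suc N)) M′ ≡ - det (suc (suc N)) M
  det-swap₀₁ N M M′ row₀ row₁ rest = begin
    det (suc (suc N)) M′                                                          ≡⟨ det-expand₂ N M′ ⟩
    sumFin (suc (suc N)) (λ j → sumFin (suc N) (laplaceTerm₂ N M′ j))
      ≡⟨ sumFin-cong (suc (suc N)) (λ j → sumFin-cong (suc N) (term j)) ⟩
    sumFin (suc (suc N)) (λ j → sumFin (suc N) (λ k → - swapped j k))
      ≡⟨ sumFin-cong (suc (suc N)) (λ j → sumFin-neg (suc N) (swapped j)) ⟩
    sumFin (suc (suc N)) (λ j → - sumFin (suc N) (swapped j))
      ≡⟨ sumFin-neg (suc (suc N)) (λ j → sumFin (suc N) (swapped j)) ⟩
    - sumFin (suc (suc N)) (λ j → sumFin (suc N) (swapped j))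
      ≡⟨ cong -_ (sumFin-swap-pairs (suc N) (laplaceTerm₂ N M)) ⟩
    - sumFin (suc (suc N)) (λ j → sumFin (suc N) (laplaceTerm₂ N M j))           ≡⟨ cong -_ (det-expand₂ N M) ⟨
    - det (suc (suc N)) M                                                         ∎
    where
    swapped : Fin (suc (suc N)) → Fin (suc N) → ℤ
    swapped j k = laplaceTerm₂ N M (punchIn j k) (pinch k j)
    term : ∀ j k → laplaceTerm₂ N M′ j k ≡ - swapped j k
    term j k =
      let sj = sign (toℕ j); sk = sign (toℕ k)
          s′j = sign (toℕ (punchIn j k)); s′k = sign (toℕ (pinch k j))
          a = M zero (punchIn j k); b = M (suc zero) j
          D = det N (minor (minor M j) k)
      in begin
      sj * M′ zero j * (sk * M′ (suc zero) (punchIn j k) * det N (minor (minor M′ j) k))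
        ≡⟨ cong₂ (λ u v → sj * u * v) (row₀ j)
             (cong₂ (λ u d → sk * u * d) (row₁ (punchIn j k)) (det-cong N (λ x y → rest x _))) ⟩
      sj * b * (sk * a * D)                      ≡⟨ regroup sj sk a b D ⟩
      - (- (sj * sk) * (a * (b * D)))            ≡⟨ cong (λ s → - (s * (a * (b * D)))) (sign-punchIn-pinch j k) ⟨
      - (s′j * s′k * (a * (b * D)))
        ≡⟨ cong₂ (λ u d → - (s′j * s′k * (a * (u * d))))
             (cong (M (suc zero)) (punchIn-pinch j k))
             (det-cong N (λ x y → cong (M (suc (suc x))) (punchIn-punchIn-pinch j k y))) ⟨
      - (s′j * s′k * (a * (M (suc zero) (punchIn (punchIn j k) (pinch k j))
                             * det N (minor (minor M (punchIn j k)) (pinch k j)))))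
        ≡⟨ cong -_ (regroup′ s′j s′k a _ _) ⟩
      - laplaceTerm₂ N M (punchIn j k) (pinch k j) ∎
      where
      regroup : ∀ sj sk a b D → sj * b * (sk * a * D) ≡ - (- (sj * sk) * (a * (b * D)))
      regroup = solve-∀
      regroup′ : ∀ s s′ a b D → s * s′ * (a * (b * D)) ≡ s * a * (s′ * b * D)
      regroup′ = solve-∀

  swapRows₀₁ : ∀ {N} → Matrix (suc (suc N)) → Matrix (suc (suc N))
  swapRows₀₁ M zero          = M (suc zero)
  swapRows₀₁ M (suc zero)    = M zero
  swapRows₀₁ M (suc (suc i)) = M (suc (suc i))

  i≡-i⇒i≡0 : ∀ i → i ≡ - i → i ≡ 0ℤ
  i≡-i⇒i≡0 (+ zero)   _  = refl
  i≡-i⇒i≡0 +[1+ _ ]   ()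
  i≡-i⇒i≡0 -[1+ _ ]   ()

  mutual
    det-equal-rows : ∀ N (M : Matrix N) r s → r ≢ s → (∀ c → M r c ≡ M s c) → det N M ≡ 0ℤ
    det-equal-rows (suc N) M zero    zero    r≢s _   = ⊥-elim (r≢s refl)
    det-equal-rows (suc N) M zero    (suc s) _   M≡ = det-equal-row₀ N M s M≡
    det-equal-rows (suc N) M (suc r) zero    _   M≡ = det-equal-row₀ N M r (sym ∘ M≡)
    det-equal-rows (suc N) M (suc r) (suc s) r≢s M≡ = det-equal-rows-suc N M r s (r≢s ∘ cong suc) M≡

    det-equal-rows-suc : ∀ N (M : Matrix (suc N)) r s → r ≢ s → (∀ c → M (suc r) c ≡ M (suc s) c) →
                         det (suc N) M ≡ 0ℤ
    det-equal-rows-suc N M r s r≢s M≡ = sumFin-zero (suc N) λ j →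
      laplaceTerm-minor≡0 N M j (det-equal-rows N (minor M j) r s r≢s (M≡ ∘ punchIn j))

    det-equal-row₀ : ∀ N (M : Matrix (suc N)) s → (∀ c → M zero c ≡ M (suc s) c) → det (suc N) M ≡ 0ℤ
    det-equal-row₀ (suc N) M zero    M≡ = i≡-i⇒i≡0 _ (det-swap₀₁ N M M M≡ (sym ∘ M≡) (λ _ _ → refl))
    det-equal-row₀ (suc N) M (suc s) M≡ = begin
      det (suc (suc N)) M                       ≡⟨ neg-involutive _ ⟨
      - - det (suc (suc N)) M
        ≡⟨ cong -_ (det-swap₀₁ N M (swapRows₀₁ M) (λ _ → refl) (λ _ → refl) (λ _ _ → refl)) ⟨
      - det (suc (suc N)) (swapRows₀₁ M)
        ≡⟨ cong -_ (det-equal-rows-suc (suc N) (swapRows₀₁ M) zero (suc s) (λ ()) M≡) ⟩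
      - 0ℤ                                      ∎

module Counting where

  open import Data.Bool as Bool using (Bool; true; false; if_then_else_)
  open import Data.Bool.Properties using (¬-not)
  open import Data.Empty using (⊥-elim)
  open import Data.Fin as Fin using (Fin; zero; suc; punchIn)
  open import Data.Fin.Properties using (suc-injective; punchInᵢ≢i; any?)
  open import Data.Nat.Properties using (+-commutativeSemigroup)
  open import Algebra.Properties.CommutativeSemigroup +-commutativeSemigroup using (x∙yz≈y∙xz)
  open import Relation.Nullary using (yes; no)
  open import Data.Nat using (_+_; _≤_; z≤n; s≤s)
  open import Data.Product using (∃; _,_)
  open import Data.Vec.Functional using (updateAt)
  open import Data.Vec.Functional.Properties using (updateAt-updates; updateAt-minimal)
  open import Function using (_∘_; const; case_of_)
  open import Relation.Binary.PropositionalEquality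

  count : ∀ {N} → (Fin N → Bool) → ℕ
  count {zero}  P = 0
  count {suc N} P = (if P zero then 1 else 0) + count (P ∘ suc)

  count-cong : ∀ {N} {P Q : Fin N → Bool} → (∀ i → P i ≡ Q i) → count P ≡ count Q
  count-cong {zero}  _   = refl
  count-cong {suc N} P≗Q = cong₂ (λ b n → (if b then 1 else 0) + n) (P≗Q zero) (count-cong (P≗Q ∘ suc))

  count-false : ∀ {N} (P : Fin N → Bool) → (∀ i → P i ≡ false) → count P ≡ 0
  count-false {zero}  P _    = refl
  count-false {suc N} P none rewrite none zero = count-false (P ∘ suc) (none ∘ suc)

  count-punchIn : ∀ {N} (P : Fin (suc N) → Bool) k → count P ≡ (if P k then 1 else 0) + count (P ∘ punchIn k)
  count-punchIn         P zero    = refl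
  count-punchIn {suc N} P (suc k) = trans (cong (_+_ (if P zero then 1 else 0)) (count-punchIn (P ∘ suc) k))
                                          (x∙yz≈y∙xz (if P zero then 1 else 0) (if P (suc k) then 1 else 0) _)

  count≡0⇒false : ∀ {N} (P : Fin N → Bool) → count P ≡ 0 → ∀ i → P i ≡ false
  count≡0⇒false {suc N} P #P≡0 i with P i | count-punchIn P i
  ... | false | _  = refl
  ... | true  | #P = case trans (sym #P≡0) #P of λ ()

  count≡suc⇒true : ∀ {N} (P : Fin N → Bool) {k} → count P ≡ suc k → ∃ λ i → P i ≡ true
  count≡suc⇒true P #P≡1+k with any? (λ i → P i Bool.≟ true)
  ... | yes found = found
  ... | no  none  = case trans (sym #P≡1+k) (count-false P (λ i → ¬-not (none ∘ (i ,_)))) of λ ()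

  count-punchIn-true : ∀ {N} (P : Fin (suc N) → Bool) {k} → P k ≡ true → count P ≡ suc (count (P ∘ punchIn k))
  count-punchIn-true P {k} Pk = trans (count-punchIn P k) (cong (λ b → (if b then 1 else 0) + count (P ∘ punchIn k)) Pk)

  count-punchIn-false : ∀ {N} (P : Fin (suc N) → Bool) {k} → P k ≡ false → count P ≡ count (P ∘ punchIn k)
  count-punchIn-false P {k} Pk = trans (count-punchIn P k) (cong (λ b → (if b then 1 else 0) + count (P ∘ punchIn k)) Pk)

  count-drop : ∀ {N} (P : Fin N → Bool) {i} → P i ≡ true → count P ≡ suc (count (updateAt P i (const false)))
  count-drop {suc N} P {i} Pi = begin
    count P                       ≡⟨ count-punchIn-true P Pi ⟩
    suc (count (P ∘ punchIn i))   ≡⟨ cong suc (count-cong λ j → updateAt-minimal (punchIn i j) i P (punchInᵢ≢i i j)) ⟨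
    suc (count (P′ ∘ punchIn i))  ≡⟨ cong suc (count-punchIn-false P′ (updateAt-updates i P)) ⟨
    suc (count P′)                ∎
    where
    open ≡-Reasoning
    P′ : Fin (suc N) → Bool
    P′ = updateAt P i (const false)

  count≥2 : ∀ {N} (P : Fin N → Bool) {r s} → r ≢ s → P r ≡ true → P s ≡ true → 2 ≤ count P
  count≥2 P {r} {s} r≢s Pr Ps
    rewrite count-drop P Pr | count-drop (updateAt P r (const false)) (trans (updateAt-minimal s r P (r≢s ∘ sym)) Ps)
    = s≤s (s≤s z≤n)

  count-image : ∀ {N K} (P : Fin N → Bool) (f : Fin K → Fin N) → (∀ a b → f a ≡ f b → a ≡ b) →
                (∀ a → P (f a) ≡ true) → (∀ i → P i ≡ true → ∃ λ a → f a ≡ i) → count P ≡ K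
  count-image {K = zero}  P f _   _    onto = count-false P (λ i → ¬-not (λ Pi → case onto i Pi of λ ()))
  count-image {N} {suc K} P f inj into onto =
    trans (count-drop P (into zero)) (cong suc (count-image P′ (f ∘ suc) inj′ into′ onto′))
    where
    P′ : Fin N → Bool
    P′ = updateAt P (f zero) (const false)
    f0≢ : ∀ a → f (suc a) ≢ f zero
    f0≢ a e = case inj _ _ e of λ ()
    inj′ : ∀ a b → f (suc a) ≡ f (suc b) → a ≡ b
    inj′ a b e = suc-injective (inj _ _ e)
    into′ : ∀ a → P′ (f (suc a)) ≡ true
    into′ a = trans (updateAt-minimal _ _ P (f0≢ a)) (into (suc a))
    onto′ : ∀ i → P′ i ≡ true → ∃ λ a → f (suc a) ≡ i
    onto′ i P′i with i Fin.≟ f zero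
    ... | yes refl = case trans (sym (updateAt-updates (f zero) P)) P′i of λ ()
    ... | no i≢f0 with onto i (trans (sym (updateAt-minimal i (f zero) P i≢f0)) P′i)
    ...   | zero  , refl = ⊥-elim (i≢f0 refl)
    ...   | suc a , fa≡i = a , fa≡i

open import Data.Fin as Fin using (Fin; zero; suc)
open import Relation.Nullary using (does)

Class : Set
Class = Fin 3

-- The vertex ⟨p^a q^b⟩ is pFull if a = m, qFull if b = m, and interior otherwise.  Classes live in
-- Fin 3 so that pigeonhole and all? from Data.Fin.Properties apply to them.
pattern interior = zero
pattern pFull    = suc zero
pattern qFull    = suc (suc zero)

classAdj : Class → Class → ℤ
classAdj pFull pFull = + 0
classAdj qFull qFull = + 0
classAdj _     _     = + 1

classCount : ∀ {N} → (Fin N → Class) → Class → ℕ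
classCount t s = Counting.count λ i → does (t i Fin.≟ s)

module ClassMatrix (d : Class → ℤ) where

  open Determinant
  open Counting
  open import Data.Integer using (_+_; _*_; -_; _-_; _^_; 0ℤ; 1ℤ; -1ℤ)
  open import Data.Integer.Properties as ℤᵖ using (*-zeroʳ; +-identityˡ; *-identityʳ)
  open import Data.Integer.Tactic.RingSolver using (solve-∀)
  open import Data.Bool using (Bool; true; false; if_then_else_; _∧_; not)
  open import Data.Fin using (punchIn; _≟_)
  open import Data.Fin.Properties using (punchInᵢ≢i; punchIn-injective; pigeonhole; <⇒≢; all?)
  open import Data.Nat using (_≤_; z≤n; s≤s)
  open import Data.Nat.Properties using (suc-injective)
  open import Data.Product using (_,_)
  open import Data.Vec.Functional using ([]; _∷_; updateAt)
  open import Data.Vec.Functional.Properties using (updateAt-updates; updateAt-minimal)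
  open import Function using (_∘_; const)
  open import Relation.Binary.PropositionalEquality
  open import Relation.Nullary using (does; Dec; yes; no)
  open import Relation.Nullary.Decidable using (dec-true; dec-false; from-yes)
  open ≡-Reasoning

  sumBool : (Bool → ℤ) → ℤ
  sumBool f = f false + f true

  sumSubsets : ((Class → Bool) → ℤ) → ℤ
  sumSubsets F = sumBool λ a → sumBool λ b → sumBool λ c → F (a ∷ b ∷ c ∷ [])

  sumBool-cong : ∀ {f g : Bool → ℤ} → (∀ b → f b ≡ g b) → sumBool f ≡ sumBool g
  sumBool-cong f≗g = cong₂ _+_ (f≗g false) (f≗g true)

  sumSubsets-cong : ∀ {F G : (Class → Bool) → ℤ} → (∀ w → F w ≡ G w) → sumSubsets F ≡ sumSubsets G
  sumSubsets-cong F≗G = sumBool-cong λ a → sumBool-cong λ b → sumBool-cong λ c → F≗G (a ∷ b ∷ c ∷ [])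

  sumBool-linear : ∀ δ (f g : Bool → ℤ) → sumBool (λ b → δ * f b + g b) ≡ δ * sumBool f + sumBool g
  sumBool-linear δ f g = distribute δ (f false) (f true) (g false) (g true)
    where
    distribute : ∀ δ u v x y → δ * u + x + (δ * v + y) ≡ δ * (u + v) + (x + y)
    distribute = solve-∀

  sumSubsets-linear : ∀ δ (F G : (Class → Bool) → ℤ) →
                      sumSubsets (λ w → δ * F w + G w) ≡ δ * sumSubsets F + sumSubsets G
  sumSubsets-linear δ F G =
    trans (sumBool-cong λ a → trans (sumBool-cong λ b → sumBool-linear δ (F₃ a b) (G₃ a b))
                                    (sumBool-linear δ (sumBool ∘ F₃ a) (sumBool ∘ G₃ a)))
          (sumBool-linear δ (λ a → sumBool (sumBool ∘ F₃ a)) (λ a → sumBool (sumBool ∘ G₃ a)))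
    where
    F₃ G₃ : Bool → Bool → Bool → ℤ
    F₃ a b c = F (a ∷ b ∷ c ∷ [])
    G₃ a b c = G (a ∷ b ∷ c ∷ [])

  classProduct : (Class → ℤ) → ℤ
  classProduct f = f interior * f pFull * f qFull

  classProduct-cong : ∀ {f g : Class → ℤ} → (∀ s → f s ≡ g s) → classProduct f ≡ classProduct g
  classProduct-cong f≗g = cong₂ _*_ (cong₂ _*_ (f≗g interior) (f≗g pFull)) (f≗g qFull)

  classProduct-zero : ∀ (f : Class → ℤ) s → f s ≡ 0ℤ → classProduct f ≡ 0ℤ
  classProduct-zero f interior fs≡0 = cong (λ x → x * f pFull * f qFull) fs≡0
  classProduct-zero f pFull    fs≡0 = trans (cong (λ x → f interior * x * f qFull) fs≡0)
                                            (cong (_* f qFull) (*-zeroʳ (f interior)))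
  classProduct-zero f qFull    fs≡0 = trans (cong (f interior * f pFull *_) fs≡0) (*-zeroʳ (f interior * f pFull))

  classProduct-linear : ∀ s₀ δ (f g h : Class → ℤ) → f s₀ ≡ δ * g s₀ + h s₀ →
                        (∀ s → s ≢ s₀ → g s ≡ f s) → (∀ s → s ≢ s₀ → h s ≡ f s) →
                        classProduct f ≡ δ * classProduct g + classProduct h
  classProduct-linear interior δ f g h f₀ g≗f h≗f = begin
    f interior * f pFull * f qFull                    ≡⟨ cong (λ x → x * f pFull * f qFull) f₀ ⟩
    (δ * g interior + h interior) * f pFull * f qFull ≡⟨ distribute δ (g interior) (h interior) (f pFull) (f qFull) ⟩
    δ * (g interior * f pFull * f qFull) + h interior * f pFull * f qFull
      ≡⟨ cong₂ (λ u v → δ * (g interior * u * v) + h interior * f pFull * f qFull) (g≗f pFull λ ()) (g≗f qFull λ ()) ⟨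
    δ * classProduct g + h interior * f pFull * f qFull
      ≡⟨ cong₂ (λ u v → δ * classProduct g + h interior * u * v) (h≗f pFull λ ()) (h≗f qFull λ ()) ⟨
    δ * classProduct g + classProduct h ∎
    where
    distribute : ∀ δ x y b c → (δ * x + y) * b * c ≡ δ * (x * b * c) + y * b * c
    distribute = solve-∀
  classProduct-linear pFull δ f g h f₀ g≗f h≗f = begin
    f interior * f pFull * f qFull                    ≡⟨ cong (λ x → f interior * x * f qFull) f₀ ⟩
    f interior * (δ * g pFull + h pFull) * f qFull    ≡⟨ distribute δ (g pFull) (h pFull) (f interior) (f qFull) ⟩
    δ * (f interior * g pFull * f qFull) + f interior * h pFull * f qFull
      ≡⟨ cong₂ (λ u v → δ * (u * g pFull * v) + f interior * h pFull * f qFull) (g≗f interior λ ()) (g≗f qFull λ ()) ⟨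
    δ * classProduct g + f interior * h pFull * f qFull
      ≡⟨ cong₂ (λ u v → δ * classProduct g + u * h pFull * v) (h≗f interior λ ()) (h≗f qFull λ ()) ⟨
    δ * classProduct g + classProduct h ∎
    where
    distribute : ∀ δ x y a c → a * (δ * x + y) * c ≡ δ * (a * x * c) + a * y * c
    distribute = solve-∀
  classProduct-linear qFull δ f g h f₀ g≗f h≗f = begin
    f interior * f pFull * f qFull                    ≡⟨ cong (f interior * f pFull *_) f₀ ⟩
    f interior * f pFull * (δ * g qFull + h qFull)    ≡⟨ distribute δ (g qFull) (h qFull) (f interior) (f pFull) ⟩
    δ * (f interior * f pFull * g qFull) + f interior * f pFull * h qFull
      ≡⟨ cong₂ (λ u v → δ * (u * v * g qFull) + f interior * f pFull * h qFull) (g≗f interior λ ()) (g≗f pFull λ ()) ⟨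
    δ * classProduct g + f interior * f pFull * h qFull
      ≡⟨ cong₂ (λ u v → δ * classProduct g + u * v * h qFull) (h≗f interior λ ()) (h≗f pFull λ ()) ⟨
    δ * classProduct g + classProduct h ∎
    where
    distribute : ∀ δ x y a b → a * b * (δ * x + y) ≡ δ * (a * b * x) + a * b * y
    distribute = solve-∀

  -- A class with a rows carrying δ on the diagonal and c rows without: the latter must enter the
  -- principal minor, w says whether one row of the class does, and the other rows contribute δ.
  weight : ℤ → Bool → ℕ → ℕ → ℤ
  weight δ false a       zero          = δ ^ a
  weight δ false a       (suc _)       = 0ℤ
  weight δ true  a       (suc zero)    = δ ^ a
  weight δ true  a       (suc (suc _)) = 0ℤ
  weight δ true  zero    zero          = 0ℤ
  weight δ true  (suc a) zero          = + suc a * δ ^ a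

  weight-step : ∀ δ w a c → weight δ w (suc a) c ≡ δ * weight δ w a c + weight δ w a (suc c)
  weight-step δ false a       zero          = sym (ℤᵖ.+-identityʳ _)
  weight-step δ false a       (suc c)       = sym (trans (ℤᵖ.+-identityʳ _) (*-zeroʳ δ))
  weight-step δ true  zero    zero          = sym (cong (_+ 1ℤ) (*-zeroʳ δ))
  weight-step δ true  (suc a) zero          = begin
    + suc (suc a) * (δ * δ ^ a)           ≡⟨ cong (_* (δ * δ ^ a)) (ℤᵖ.pos-+ 1 (suc a)) ⟩
    (1ℤ + + suc a) * (δ * δ ^ a)          ≡⟨ distribute δ (+ suc a) (δ ^ a) ⟩
    δ * (+ suc a * δ ^ a) + δ * δ ^ a     ∎
    where
    distribute : ∀ δ n p → (1ℤ + n) * (δ * p) ≡ δ * (n * p) + δ * p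
    distribute = solve-∀
  weight-step δ true  a       (suc zero)    = sym (ℤᵖ.+-identityʳ _)
  weight-step δ true  a       (suc (suc c)) = sym (trans (ℤᵖ.+-identityʳ _) (*-zeroʳ δ))

  weight-vanishes : ∀ δ w a {c} → 2 ≤ c → weight δ w a c ≡ 0ℤ
  weight-vanishes δ false a (s≤s (s≤s _)) = refl
  weight-vanishes δ true  a (s≤s (s≤s _)) = refl

  principalMinor : (Class → Bool) → ℤ
  principalMinor w = det 3 λ r c → if w r ∧ w c then - classAdj r c else if does (r ≟ c) then 1ℤ else 0ℤ

  expansionTerm : (Class → ℕ) → (Class → ℕ) → (Class → Bool) → ℤ
  expansionTerm A C w = principalMinor w * classProduct λ s → weight (d s) (w s) (A s) (C s)

  expansion : (Class → ℕ) → (Class → ℕ) → ℤ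
  expansion A C = sumSubsets (expansionTerm A C)

  pureMatrix : ∀ {N} → (Fin N → Class) → Matrix N
  pureMatrix t i j = - classAdj (t i) (t j)

  PureExpansion : ∀ {N} → (Fin N → Class) → Set
  PureExpansion {N} t = det N (pureMatrix t) ≡ expansion (const 0) (classCount t)

  pureExpansion? : ∀ {N} (t : Fin N → Class) → Dec (PureExpansion t)
  pureExpansion? t = _ ℤᵖ.≟ _

  pureExpansion₁ : ∀ a → PureExpansion (a ∷ [])
  pureExpansion₁ = from-yes (all? λ a → pureExpansion? (a ∷ []))

  pureExpansion₂ : ∀ a b → PureExpansion (a ∷ b ∷ [])
  pureExpansion₂ = from-yes (all? λ a → all? λ b → pureExpansion? (a ∷ b ∷ []))

  pureExpansion₃ : ∀ a b c → PureExpansion (a ∷ b ∷ c ∷ [])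
  pureExpansion₃ = from-yes (all? λ a → all? λ b → all? λ c → pureExpansion? (a ∷ b ∷ c ∷ []))

  expansion-cong : ∀ {A A′ C C′ : Class → ℕ} → (∀ s → A s ≡ A′ s) → (∀ s → C s ≡ C′ s) →
                   expansion A C ≡ expansion A′ C′
  expansion-cong A≗A′ C≗C′ = sumSubsets-cong λ w → cong (principalMinor w *_)
    (classProduct-cong λ s → cong₂ (weight (d s) (w s)) (A≗A′ s) (C≗C′ s))

  expansion-vanishes : ∀ (A C : Class → ℕ) s → 2 ≤ C s → expansion A C ≡ 0ℤ
  expansion-vanishes A C s 2≤Cs = sumSubsets-cong {F = expansionTerm A C} {G = const 0ℤ} λ w →
    trans (cong (principalMinor w *_)
                (classProduct-zero (λ s → weight (d s) (w s) (A s) (C s)) s (weight-vanishes (d s) (w s) (A s) 2≤Cs)))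
          (*-zeroʳ (principalMinor w))

  PureExpansion-cong : ∀ {N} (t t′ : Fin N → Class) → (∀ i → t i ≡ t′ i) → PureExpansion t′ → PureExpansion t
  PureExpansion-cong {N} t t′ t≗t′ eq = begin
    det N (pureMatrix t)                    ≡⟨ det-cong N (λ i j → cong₂ (λ a b → - classAdj a b) (t≗t′ i) (t≗t′ j)) ⟩
    det N (pureMatrix t′)                   ≡⟨ eq ⟩
    expansion (const 0) (classCount t′)
      ≡⟨ expansion-cong {A = const 0} {A′ = const 0} (λ _ → refl)
                        (λ s → count-cong λ i → cong (λ a → does (a ≟ s)) (t≗t′ i)) ⟨
    expansion (const 0) (classCount t)      ∎

  pureExpansion : ∀ {N} (t : Fin N → Class) → PureExpansion t
  pureExpansion {0} t = refl
  pureExpansion {1} t = PureExpansion-cong t (t zero ∷ []) (λ { zero → refl }) (pureExpansion₁ (t zero))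
  pureExpansion {2} t = PureExpansion-cong t (t zero ∷ t (suc zero) ∷ []) (λ { zero → refl ; (suc zero) → refl })
                                           (pureExpansion₂ (t zero) (t (suc zero)))
  pureExpansion {3} t = PureExpansion-cong t (t zero ∷ t (suc zero) ∷ t (suc (suc zero)) ∷ [])
                                           (λ { zero → refl ; (suc zero) → refl ; (suc (suc zero)) → refl })
                                           (pureExpansion₃ (t zero) (t (suc zero)) (t (suc (suc zero))))
  pureExpansion {suc (suc (suc (suc N)))} t with pigeonhole (s≤s (s≤s (s≤s (s≤s z≤n)))) t
  ... | i , j , i<j , tᵢ≡tⱼ = begin
    det _ (pureMatrix t)
      ≡⟨ det-equal-rows _ (pureMatrix t) i j (<⇒≢ i<j) (λ c → cong (λ a → - classAdj a (t c)) tᵢ≡tⱼ) ⟩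
    0ℤ                                  ≡⟨ expansion-vanishes (const 0) (classCount t) (t i) two ⟨
    expansion (const 0) (classCount t)  ∎
    where
    two : 2 ≤ classCount t (t i)
    two = count≥2 _ (<⇒≢ i<j) (dec-true (t i ≟ t i) refl) (dec-true (t j ≟ t i) (sym tᵢ≡tⱼ))

  bump : Class → (Class → ℕ) → Class → ℕ
  bump s₀ A s = (if does (s₀ ≟ s) then 1 else 0) ℕ.+ A s

  bump-here : ∀ s₀ (A : Class → ℕ) → bump s₀ A s₀ ≡ suc (A s₀)
  bump-here s₀ A = cong (λ b → (if b then 1 else 0) ℕ.+ A s₀) (dec-true (s₀ ≟ s₀) refl)

  bump-elsewhere : ∀ s₀ (A : Class → ℕ) s → s ≢ s₀ → bump s₀ A s ≡ A s
  bump-elsewhere s₀ A s s≢s₀ = cong (λ b → (if b then 1 else 0) ℕ.+ A s) (dec-false (s₀ ≟ s) (s≢s₀ ∘ sym))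

  expansion-step : ∀ s₀ (A C : Class → ℕ) →
                   expansion (bump s₀ A) C ≡ d s₀ * expansion A C + expansion A (bump s₀ C)
  expansion-step s₀ A C = begin
    sumSubsets (expansionTerm (bump s₀ A) C)
      ≡⟨ sumSubsets-cong term ⟩
    sumSubsets (λ w → d s₀ * expansionTerm A C w + expansionTerm A (bump s₀ C) w)
      ≡⟨ sumSubsets-linear (d s₀) (expansionTerm A C) (expansionTerm A (bump s₀ C)) ⟩
    d s₀ * expansion A C + expansion A (bump s₀ C) ∎
    where
    term : ∀ w → expansionTerm (bump s₀ A) C w ≡ d s₀ * expansionTerm A C w + expansionTerm A (bump s₀ C) w
    term w = trans (cong (principalMinor w *_) (classProduct-linear s₀ (d s₀) _ _ _ here elsewhere elsewhere′))
                   (distribute (principalMinor w) (d s₀) _ _)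
      where
      here : weight (d s₀) (w s₀) (bump s₀ A s₀) (C s₀)
             ≡ d s₀ * weight (d s₀) (w s₀) (A s₀) (C s₀) + weight (d s₀) (w s₀) (A s₀) (bump s₀ C s₀)
      here rewrite bump-here s₀ A | bump-here s₀ C = weight-step (d s₀) (w s₀) (A s₀) (C s₀)
      elsewhere : ∀ s → s ≢ s₀ → weight (d s) (w s) (A s) (C s) ≡ weight (d s) (w s) (bump s₀ A s) (C s)
      elsewhere s s≢s₀ = cong (λ a → weight (d s) (w s) a (C s)) (sym (bump-elsewhere s₀ A s s≢s₀))
      elsewhere′ : ∀ s → s ≢ s₀ → weight (d s) (w s) (A s) (bump s₀ C s) ≡ weight (d s) (w s) (bump s₀ A s) (C s)
      elsewhere′ s s≢s₀ = cong₂ (weight (d s) (w s)) (sym (bump-elsewhere s₀ A s s≢s₀)) (bump-elsewhere s₀ C s s≢s₀)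
      distribute : ∀ m δ x y → m * (δ * x + y) ≡ δ * (m * x) + m * y
      distribute = solve-∀

  record Shaped {N} (t : Fin N → Class) (ε : Fin N → Bool) (M : Matrix N) : Set where
    field
      diagonal    : ∀ i → M i i ≡ (if ε i then d (t i) else 0ℤ) - classAdj (t i) (t i)
      offDiagonal : ∀ i j → i ≢ j → M i j ≡ - classAdj (t i) (t j)
  open Shaped

  tally : ∀ {N} → (Fin N → Bool) → (Fin N → Class) → Class → ℕ
  tally ε t s = count λ i → ε i ∧ does (t i ≟ s)

  tally-cong : ∀ {N} {ε ε′ : Fin N → Bool} t s → (∀ i → ε i ≡ ε′ i) → tally ε t s ≡ tally ε′ t s
  tally-cong t s ε≗ε′ = count-cong λ i → cong (_∧ does (t i ≟ s)) (ε≗ε′ i)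

  tally-active : ∀ {N} (ε : Fin (suc N) → Bool) t {i} s → ε i ≡ true →
                 tally ε t s ≡ bump (t i) (tally (ε ∘ punchIn i) (t ∘ punchIn i)) s
  tally-active ε t {i} s εi = trans (count-punchIn (λ j → ε j ∧ does (t j ≟ s)) i)
    (cong (λ e → (if e ∧ does (t i ≟ s) then 1 else 0) ℕ.+ tally (ε ∘ punchIn i) (t ∘ punchIn i) s) εi)

  tally-inactive : ∀ {N} (ε : Fin (suc N) → Bool) t {i} s → ε i ≡ false →
                   tally ε t s ≡ tally (ε ∘ punchIn i) (t ∘ punchIn i) s
  tally-inactive ε t {i} s εi = count-punchIn-false (λ j → ε j ∧ does (t j ≟ s)) (cong (_∧ does (t i ≟ s)) εi)

  shaped-remove : ∀ {N t ε} {M : Matrix (suc N)} → Shaped t ε M → ∀ i →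
                  Shaped (t ∘ punchIn i) (ε ∘ punchIn i) (remove i i M)
  shaped-remove sh i = record
    { diagonal    = λ a → diagonal sh (punchIn i a)
    ; offDiagonal = λ a b a≢b → offDiagonal sh _ _ (a≢b ∘ punchIn-injective i a b)
    }

  deactivate : ∀ {N} → (Fin N → Class) → Fin N → Matrix N → Matrix N
  deactivate t i M = updateAt M i λ _ c → - classAdj (t i) (t c)

  shaped-deactivate : ∀ {N t ε} {M : Matrix N} → Shaped t ε M → ∀ i →
                      Shaped t (updateAt ε i (const false)) (deactivate t i M)
  shaped-deactivate {t = t} {ε} {M} sh i = record { diagonal = diagonal′ ; offDiagonal = offDiagonal′ }
    where
    diagonal′ : ∀ r → deactivate t i M r r ≡ (if updateAt ε i (const false) r then d (t r) else 0ℤ) - classAdj (t r) (t r)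
    diagonal′ r with r ≟ i
    ... | yes refl = begin
      deactivate t r M r r                          ≡⟨ cong-app (updateAt-updates r M) r ⟩
      - classAdj (t r) (t r)                        ≡⟨ +-identityˡ _ ⟨
      0ℤ - classAdj (t r) (t r)                     ≡⟨ cong (λ e → (if e then d (t r) else 0ℤ) - classAdj (t r) (t r))
                                                            (updateAt-updates r ε) ⟨
      (if updateAt ε r (const false) r then d (t r) else 0ℤ) - classAdj (t r) (t r) ∎
    ... | no r≢i   = begin
      deactivate t i M r r                          ≡⟨ cong-app (updateAt-minimal r i M r≢i) r ⟩
      M r r                                         ≡⟨ diagonal sh r ⟩
      (if ε r then d (t r) else 0ℤ) - classAdj (t r) (t r)
        ≡⟨ cong (λ e → (if e then d (t r) else 0ℤ) - classAdj (t r) (t r)) (updateAt-minimal r i ε r≢i) ⟨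
      (if updateAt ε i (const false) r then d (t r) else 0ℤ) - classAdj (t r) (t r) ∎
    offDiagonal′ : ∀ r c → r ≢ c → deactivate t i M r c ≡ - classAdj (t r) (t c)
    offDiagonal′ r c r≢c with r ≟ i
    ... | yes refl = cong-app (updateAt-updates r M) c
    ... | no r≢i   = trans (cong-app (updateAt-minimal r i M r≢i) c) (offDiagonal sh r c r≢c)

  det-split : ∀ {N} t ε (M : Matrix (suc N)) i → ε i ≡ true → Shaped t ε M →
              det (suc N) M ≡ d (t i) * det N (remove i i M) + det (suc N) (deactivate t i M)
  det-split {N} t ε M i εi sh = begin
    det (suc N) M
      ≡⟨ det-linear-row (suc N) M U V i (d (t i)) row unchanged unchanged ⟩
    d (t i) * det (suc N) U + det (suc N) V
      ≡⟨ cong (λ u → d (t i) * u + det (suc N) V) (det-unit-diagonal N U i unit-here unit-elsewhere) ⟩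
    d (t i) * det N (remove i i U) + det (suc N) V
      ≡⟨ cong (λ u → d (t i) * u + det (suc N) V)
              (det-cong N λ a b → sym (unchanged (punchIn i a) (punchInᵢ≢i i a) (punchIn i b))) ⟩
    d (t i) * det N (remove i i M) + det (suc N) V ∎
    where
    unitRow : Fin (suc N) → ℤ
    unitRow c = if does (c ≟ i) then 1ℤ else 0ℤ
    U V : Matrix (suc N)
    U = updateAt M i (const unitRow)
    V = deactivate t i M
    unit-here : U i i ≡ 1ℤ
    unit-here = trans (cong-app (updateAt-updates i M) i) (cong (if_then 1ℤ else 0ℤ) (dec-true (i ≟ i) refl))
    unit-elsewhere : ∀ c → c ≢ i → U i c ≡ 0ℤ
    unit-elsewhere c c≢i = trans (cong-app (updateAt-updates i M) c) (cong (if_then 1ℤ else 0ℤ) (dec-false (c ≟ i) c≢i))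
    entry : ∀ c → M i c ≡ d (t i) * unitRow c - classAdj (t i) (t c)
    entry c with c ≟ i
    ... | yes refl = begin
      M i i                                            ≡⟨ diagonal sh i ⟩
      (if ε i then d (t i) else 0ℤ) - classAdj (t i) (t i)
        ≡⟨ cong (λ e → (if e then d (t i) else 0ℤ) - classAdj (t i) (t i)) εi ⟩
      d (t i) - classAdj (t i) (t i)                   ≡⟨ cong (λ u → u - classAdj (t i) (t i)) (*-identityʳ (d (t i))) ⟨
      d (t i) * 1ℤ - classAdj (t i) (t i)              ∎
    ... | no c≢i = begin
      M i c                                            ≡⟨ offDiagonal sh i c (c≢i ∘ sym) ⟩
      - classAdj (t i) (t c)                           ≡⟨ +-identityˡ _ ⟨
      0ℤ - classAdj (t i) (t c)                        ≡⟨ cong (_- classAdj (t i) (t c)) (*-zeroʳ (d (t i))) ⟨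
      d (t i) * 0ℤ - classAdj (t i) (t c)              ∎
    row : ∀ c → M i c ≡ d (t i) * U i c + V i c
    row c = trans (entry c) (sym (cong₂ (λ u v → d (t i) * u + v) (cong-app (updateAt-updates i M) c)
                                                                (cong-app (updateAt-updates i M) c)))
    unchanged : ∀ {f} r → r ≢ i → ∀ c → M r c ≡ updateAt M i f r c
    unchanged r r≢i = cong-app (sym (updateAt-minimal r i M r≢i))

  det-shaped : ∀ k {N} (t : Fin N → Class) (ε : Fin N → Bool) (M : Matrix N) → count ε ≡ k → Shaped t ε M →
               det N M ≡ expansion (tally ε t) (tally (not ∘ ε) t)
  det-shaped zero {N} t ε M #ε≡0 sh = begin
    det N M                                   ≡⟨ det-cong N pure ⟩
    det N (pureMatrix t)                      ≡⟨ pureExpansion t ⟩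
    expansion (const 0) (classCount t)        ≡⟨ expansion-cong none all ⟩
    expansion (tally ε t) (tally (not ∘ ε) t) ∎
    where
    inactive : ∀ i → ε i ≡ false
    inactive = count≡0⇒false ε #ε≡0
    pure : ∀ i j → M i j ≡ pureMatrix t i j
    pure i j with i ≟ j
    ... | yes refl = trans (diagonal sh i)
                           (trans (cong (λ e → (if e then d (t i) else 0ℤ) - classAdj (t i) (t i)) (inactive i))
                                  (+-identityˡ _))
    ... | no i≢j   = offDiagonal sh i j i≢j
    none : ∀ s → 0 ≡ tally ε t s
    none s = sym (count-false _ λ i → cong (_∧ does (t i ≟ s)) (inactive i))
    all : ∀ s → classCount t s ≡ tally (not ∘ ε) t s
    all s = count-cong λ i → cong (λ e → not e ∧ does (t i ≟ s)) (sym (inactive i))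
  det-shaped (suc k) {suc N} t ε M #ε≡1+k sh with count≡suc⇒true ε #ε≡1+k
  ... | i , εi = begin
    det (suc N) M
      ≡⟨ det-split t ε M i εi sh ⟩
    d (t i) * det N (remove i i M) + det (suc N) (deactivate t i M)
      ≡⟨ cong₂ (λ u v → d (t i) * u + v)
           (det-shaped k (t ∘ punchIn i) (ε ∘ punchIn i) (remove i i M) #removed (shaped-remove sh i))
           (det-shaped k t ε′ (deactivate t i M) #deactivated (shaped-deactivate sh i)) ⟩
    d (t i) * expansion A₁ C₁ + expansion (tally ε′ t) (tally (not ∘ ε′) t)
      ≡⟨ cong (_+_ (d (t i) * expansion A₁ C₁)) (expansion-cong A′≗A₁ C′≗C₁+) ⟩
    d (t i) * expansion A₁ C₁ + expansion A₁ (bump (t i) C₁)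
      ≡⟨ expansion-step (t i) A₁ C₁ ⟨
    expansion (bump (t i) A₁) C₁
      ≡⟨ expansion-cong A≗A₁+ C≗C₁ ⟨
    expansion (tally ε t) (tally (not ∘ ε) t) ∎
    where
    ε′ : Fin (suc N) → Bool
    ε′ = updateAt ε i (const false)
    A₁ C₁ : Class → ℕ
    A₁ = tally (ε ∘ punchIn i) (t ∘ punchIn i)
    C₁ = tally (not ∘ ε ∘ punchIn i) (t ∘ punchIn i)
    ε′∘punchIn : ∀ a → ε′ (punchIn i a) ≡ ε (punchIn i a)
    ε′∘punchIn a = updateAt-minimal (punchIn i a) i ε (punchInᵢ≢i i a)
    #removed : count (ε ∘ punchIn i) ≡ k
    #removed = suc-injective (trans (sym (count-punchIn-true ε εi)) #ε≡1+k)
    #deactivated : count ε′ ≡ k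
    #deactivated = suc-injective (trans (sym (count-drop ε εi)) #ε≡1+k)
    A≗A₁+ : ∀ s → tally ε t s ≡ bump (t i) A₁ s
    A≗A₁+ s = tally-active ε t s εi
    C≗C₁ : ∀ s → tally (not ∘ ε) t s ≡ C₁ s
    C≗C₁ s = tally-inactive (not ∘ ε) t s (cong not εi)
    A′≗A₁ : ∀ s → tally ε′ t s ≡ A₁ s
    A′≗A₁ s = trans (tally-inactive ε′ t s (updateAt-updates i ε)) (tally-cong (t ∘ punchIn i) s ε′∘punchIn)
    C′≗C₁+ : ∀ s → tally (not ∘ ε′) t s ≡ bump (t i) C₁ s
    C′≗C₁+ s = trans (tally-active (not ∘ ε′) t s (cong not (updateAt-updates i ε)))
                     (cong (_ ℕ.+_) (tally-cong (t ∘ punchIn i) s (cong not ∘ ε′∘punchIn)))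

  det-classMatrix : ∀ N (t : Fin N → Class) (M : Matrix N) →
                    (∀ i → M i i ≡ d (t i) - classAdj (t i) (t i)) →
                    (∀ i j → i ≢ j → M i j ≡ - classAdj (t i) (t j)) →
                    det N M ≡ expansion (classCount t) (const 0)
  det-classMatrix N t M diag off = begin
    det N M
      ≡⟨ det-shaped _ t (const true) M refl (record { diagonal = diag ; offDiagonal = off }) ⟩
    expansion (classCount t) (tally (const false) t)
      ≡⟨ expansion-cong {A = classCount t} {C = tally (const false) t} (λ _ → refl) (λ _ → count-false {N} _ λ _ → refl) ⟩
    expansion (classCount t) (const 0)                 ∎

  -- The principal minors of −classAdj are 1 on ∅, 0 on {pFull} and on {qFull}, and −1 otherwise.
  expansion-without-pure-rows : ∀ A →
    let u s = weight (d s) false (A s) 0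
        v s = weight (d s) true (A s) 0
    in expansion A (const 0) ≡ u interior * u pFull * u qFull - v interior * u pFull * u qFull
                                 - v interior * v pFull * u qFull - v interior * u pFull * v qFull
                                 - u interior * v pFull * v qFull - v interior * v pFull * v qFull
  expansion-without-pure-rows A = simplify (u interior) (u pFull) (u qFull) (v interior) (v pFull) (v qFull)
    where
    u v : Class → ℤ
    u s = weight (d s) false (A s) 0
    v s = weight (d s) true (A s) 0
    simplify : ∀ uᵢ uₚ u_q vᵢ vₚ v_q →
      ((1ℤ * (uᵢ * uₚ * u_q) + 0ℤ * (uᵢ * uₚ * v_q)) + (0ℤ * (uᵢ * vₚ * u_q) + -1ℤ * (uᵢ * vₚ * v_q)))
      + ((-1ℤ * (vᵢ * uₚ * u_q) + -1ℤ * (vᵢ * uₚ * v_q)) + (-1ℤ * (vᵢ * vₚ * u_q) + -1ℤ * (vᵢ * vₚ * v_q)))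
      ≡ uᵢ * uₚ * u_q - vᵢ * uₚ * u_q - vᵢ * vₚ * u_q - vᵢ * uₚ * v_q - uᵢ * vₚ * v_q - vᵢ * vₚ * v_q
    simplify = solve-∀

module PrimePowers where

  open import Data.Nat using (_*_; _^_; _≤_; _<_; z≤n; s≤s)
  open import Data.Nat.Properties
  open import Data.Nat.Divisibility
  open import Data.Nat.Primality using (euclidsLemma; prime⇒irreducible; prime⇒nonZero; prime⇒nonTrivial)
  open import Data.Nat.Coprimality using (Coprime; coprime-divisor)
  open import Data.Empty using (⊥; ⊥-elim)
  open import Data.Product using (∃₂; _×_; _,_)
  open import Data.Sum using (_⊎_; inj₁; inj₂)
  open import Relation.Binary.PropositionalEquality
  open import Relation.Nullary using (¬_; yes; no)
  open import Function using (_∘_)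

  <⊎< : ∀ {x y k} → x ≤ k → y ≤ k → (x ≡ k → y ≡ k → ⊥) → x < k ⊎ y < k
  <⊎< x≤k y≤k ¬both with m≤n⇒m<n∨m≡n x≤k | m≤n⇒m<n∨m≡n y≤k
  ... | inj₁ x<k | _        = inj₁ x<k
  ... | inj₂ _   | inj₁ y<k = inj₂ y<k
  ... | inj₂ x≡k | inj₂ y≡k = ⊥-elim (¬both x≡k y≡k)

  0<⊎0< : ∀ x y → (x ≡ 0 → y ≡ 0 → ⊥) → 0 < x ⊎ 0 < y
  0<⊎0< (suc _) _       _     = inj₁ (s≤s z≤n)
  0<⊎0< zero    (suc _) _     = inj₂ (s≤s z≤n)
  0<⊎0< zero    zero    ¬both = ⊥-elim (¬both refl refl)

  prime>1 : ∀ {r} → Prime r → 1 < r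
  prime>1 {r} r-prime = ℕ.nonTrivial⇒n>1 r {{prime⇒nonTrivial r-prime}}

  ^-pos : ∀ {r} → Prime r → ∀ a → 0 < r ^ a
  ^-pos {r} r-prime a = m^n>0 r {{prime⇒nonZero r-prime}} a

  prime∤⇒coprime : ∀ {r d} → Prime r → ¬ r ∣ d → Coprime d r
  prime∤⇒coprime r-prime r∤d (c∣d , c∣r) with prime⇒irreducible r-prime c∣r
  ... | inj₁ c≡1 = c≡1
  ... | inj₂ refl = ⊥-elim (r∤d c∣d)

  ^-∣-^ : ∀ r {a b} → a ≤ b → r ^ a ∣ r ^ b
  ^-∣-^ r {a} le with m≤n⇒∃[o]m+o≡n le
  ... | k , refl = divides (r ^ k) (trans (^-distribˡ-+-* r a k) (*-comm (r ^ a) (r ^ k)))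

  ∣r^a*y⇒≡r^a′*d′ : ∀ {r} → Prime r → ∀ a {d y} → d ∣ r ^ a * y →
                    ∃₂ λ a′ d′ → a′ ≤ a × d ≡ r ^ a′ * d′ × d′ ∣ y
  ∣r^a*y⇒≡r^a′*d′ r-prime zero {d} {y} d∣y = 0 , d , z≤n , sym (+-identityʳ d) , subst (d ∣_) (+-identityʳ y) d∣y
  ∣r^a*y⇒≡r^a′*d′ {r} r-prime (suc a) {d} {y} d∣ with r ∣? d
  ... | yes (divides k refl) =
    let instance _ = prime⇒nonZero r-prime
        k∣ = *-cancelˡ-∣ r (subst₂ _∣_ (*-comm k r) (*-assoc r (r ^ a) y) d∣)
        (a′ , d′ , a′≤a , k≡ , d′∣y) = ∣r^a*y⇒≡r^a′*d′ r-prime a k∣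
    in suc a′ , d′ , s≤s a′≤a , trans (cong (_* r) k≡) (rotate (r ^ a′) d′ r) , d′∣y
    where
    rotate : ∀ x y z → x * y * z ≡ z * x * y
    rotate x y z = trans (*-comm (x * y) z) (sym (*-assoc z x y))
  ... | no r∤d =
    let (a′ , d′ , a′≤a , d≡ , d′∣y) =
          ∣r^a*y⇒≡r^a′*d′ r-prime a
            (coprime-divisor (prime∤⇒coprime r-prime r∤d) (subst (d ∣_) (*-assoc r (r ^ a) y) d∣))
    in a′ , d′ , m≤n⇒m≤1+n a′≤a , d≡ , d′∣y

  prime∤prime^ : ∀ {p q} → Prime p → Prime q → p ≢ q → ∀ b → ¬ p ∣ q ^ b
  prime∤prime^ p-prime q-prime p≢q zero    p∣1 = <-irrefl (sym (∣1⇒≡1 p∣1)) (prime>1 p-prime)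
  prime∤prime^ p-prime q-prime p≢q (suc b) p∣q^1+b with euclidsLemma _ _ p-prime p∣q^1+b
  ... | inj₂ p∣q^b = prime∤prime^ p-prime q-prime p≢q b p∣q^b
  ... | inj₁ p∣q with prime⇒irreducible q-prime p∣q
  ...   | inj₁ refl = <-irrefl refl (prime>1 p-prime)
  ...   | inj₂ p≡q  = p≢q p≡q

  p^c∣p^a*q^b⇒c≤a : ∀ {p q} → Prime p → Prime q → p ≢ q → ∀ a b c → p ^ c ∣ p ^ a * q ^ b → c ≤ a
  p^c∣p^a*q^b⇒c≤a {p} p-prime q-prime p≢q a b c p^c∣ with c ≤? a
  ... | yes c≤a = c≤a
  ... | no  c≰a =
    let instance _ = m^n≢0 p a {{prime⇒nonZero p-prime}}
        p^a*p∣p^c = subst (_∣ p ^ c) (*-comm p (p ^ a)) (^-∣-^ p (≰⇒> c≰a))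
    in ⊥-elim (prime∤prime^ p-prime q-prime p≢q b (*-cancelˡ-∣ (p ^ a) (∣-trans p^a*p∣p^c p^c∣)))

  q^b∣p^a*x⇒q^b∣x : ∀ {p q} → Prime p → Prime q → p ≢ q → ∀ a b x → q ^ b ∣ p ^ a * x → q ^ b ∣ x
  q^b∣p^a*x⇒q^b∣x         p-prime q-prime p≢q zero    b x q^b∣ = subst (_ ∣_) (+-identityʳ x) q^b∣
  q^b∣p^a*x⇒q^b∣x {p} {q} p-prime q-prime p≢q (suc a) b x q^b∣ =
    q^b∣p^a*x⇒q^b∣x p-prime q-prime p≢q a b x
      (coprime-divisor (prime∤⇒coprime p-prime (prime∤prime^ p-prime q-prime p≢q b))
                       (subst (q ^ b ∣_) (*-assoc p (p ^ a) x) q^b∣))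

  module DistinctPrimes {p q : ℕ} (p-prime : Prime p) (q-prime : Prime q) (p≢q : p ≢ q) where

    q^c∣p^a*q^b⇒c≤b : ∀ a b c → q ^ c ∣ p ^ a * q ^ b → c ≤ b
    q^c∣p^a*q^b⇒c≤b a b c q^c∣ =
      p^c∣p^a*q^b⇒c≤a q-prime p-prime (p≢q ∘ sym) b a c (subst (q ^ c ∣_) (*-comm (p ^ a) (q ^ b)) q^c∣)

    ∣p^a*q^b⇒≡p^a′*q^b′ : ∀ a b {d} → d ∣ p ^ a * q ^ b →
                          ∃₂ λ a′ b′ → a′ ≤ a × b′ ≤ b × d ≡ p ^ a′ * q ^ b′
    ∣p^a*q^b⇒≡p^a′*q^b′ a b {d} d∣ =
      let (a′ , d′ , a′≤a , d≡ , d′∣q^b) = ∣r^a*y⇒≡r^a′*d′ p-prime a d∣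
          (b′ , d″ , b′≤b , d′≡ , d″∣1) =
            ∣r^a*y⇒≡r^a′*d′ q-prime b (subst (d′ ∣_) (sym (*-identityʳ (q ^ b))) d′∣q^b)
      in a′ , b′ , a′≤a , b′≤b ,
         trans d≡ (cong (p ^ a′ *_) (trans d′≡ (trans (cong (q ^ b′ *_) (∣1⇒≡1 d″∣1)) (*-identityʳ (q ^ b′)))))

    p^a*q^b-injective : ∀ {a b a′ b′} → p ^ a * q ^ b ≡ p ^ a′ * q ^ b′ → a ≡ a′ × b ≡ b′
    p^a*q^b-injective {a} {b} {a′} {b′} eq =
      ≤-antisym (p^c∣p^a*q^b⇒c≤a p-prime q-prime p≢q a′ b′ a (subst (p ^ a ∣_) eq (m∣m*n (q ^ b))))
                (p^c∣p^a*q^b⇒c≤a p-prime q-prime p≢q a b a′ (subst (p ^ a′ ∣_) (sym eq) (m∣m*n (q ^ b′)))) ,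
      ≤-antisym (q^c∣p^a*q^b⇒c≤b a′ b′ b (subst (q ^ b ∣_) eq (n∣m*n (p ^ a))))
                (q^c∣p^a*q^b⇒c≤b a b b′ (subst (q ^ b′ ∣_) (sym eq) (n∣m*n (p ^ a′))))

    p^a∣y⇒q^b∣y⇒p^a*q^b∣y : ∀ a b {y} → p ^ a ∣ y → q ^ b ∣ y → p ^ a * q ^ b ∣ y
    p^a∣y⇒q^b∣y⇒p^a*q^b∣y a b (divides k refl) q^b∣y
      with q^b∣p^a*x⇒q^b∣x p-prime q-prime p≢q a b k (subst (q ^ b ∣_) (*-comm k (p ^ a)) q^b∣y)
    ... | divides l refl = divides l (trans (*-assoc l (q ^ b) (p ^ a)) (cong (l *_) (*-comm (q ^ b) (p ^ a))))

    p^a*q^b∣p^a′*q^b′ : ∀ {a b a′ b′} → a ≤ a′ → b ≤ b′ → p ^ a * q ^ b ∣ p ^ a′ * q ^ b′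
    p^a*q^b∣p^a′*q^b′ a≤a′ b≤b′ = *-pres-∣ (^-∣-^ p a≤a′) (^-∣-^ q b≤b′)

    p^a*q^b>0 : ∀ a b → 0 < p ^ a * q ^ b
    p^a*q^b>0 a b = *-mono-< (^-pos p-prime a) (^-pos q-prime b)

    p^a*q^b<p^m*q^m : ∀ {a b m} → a ≤ m → b ≤ m → a < m ⊎ b < m → p ^ a * q ^ b < p ^ m * q ^ m
    p^a*q^b<p^m*q^m {a} {b} {m} a≤m b≤m (inj₁ a<m) =
      <-≤-trans (*-monoˡ-< (q ^ b) {{m^n≢0 q b {{prime⇒nonZero q-prime}}}} (^-monoʳ-< p (prime>1 p-prime) a<m))
                (*-monoʳ-≤ (p ^ m) (^-monoʳ-≤ q {{prime⇒nonZero q-prime}} b≤m))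
    p^a*q^b<p^m*q^m {a} {b} {m} a≤m b≤m (inj₂ b<m) =
      ≤-<-trans (*-monoˡ-≤ (q ^ b) (^-monoʳ-≤ p {{prime⇒nonZero p-prime}} a≤m))
                (*-monoʳ-< (p ^ m) {{m^n≢0 p m {{prime⇒nonZero p-prime}}}} (^-monoʳ-< q (prime>1 q-prime) b<m))

    p^a*q^b≡1⇒ : ∀ a b → p ^ a * q ^ b ≡ 1 → a ≡ 0 × b ≡ 0
    p^a*q^b≡1⇒ a b eq =
      exponent p-prime a (m*n≡1⇒m≡1 (p ^ a) (q ^ b) eq) , exponent q-prime b (m*n≡1⇒n≡1 (p ^ a) (q ^ b) eq)
      where
      exponent : ∀ {r} → Prime r → ∀ a → r ^ a ≡ 1 → a ≡ 0
      exponent r-prime a r^a≡1 with m^n≡1⇒n≡0∨m≡1 _ a r^a≡1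
      ... | inj₁ a≡0 = a≡0
      ... | inj₂ r≡1 = ⊥-elim (<-irrefl (sym r≡1) (prime>1 r-prime))

module Ideals where

  open import Data.Nat using (_*_; _<_; >-nonZero)
  open import Data.Nat.Properties using (+-comm; +-identityʳ; <-irrefl; <-≤-trans)
  open import Data.Nat.Divisibility
  open import Data.Empty using (⊥)
  open import Data.Product using (_,_; proj₁)
  open import Data.Sum using (_⊎_; inj₁; inj₂)
  open import Relation.Binary.PropositionalEquality
  open import Relation.Nullary using (¬_)

  ∣⇒¬0<y<n : ∀ {n y} → n ∣ y → 0 < y → y < n → ⊥
  ∣⇒¬0<y<n n∣y 0<y y<n = <-irrefl refl (<-≤-trans y<n (∣⇒≤ {{>-nonZero 0<y}} n∣y))

  nonzero⇒¬n∣gen : ∀ {n} (I : Ideal n) → NonzeroIdeal n I → ¬ n ∣ gen I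
  nonzero⇒¬n∣gen I (x , 0<x , x<n , gen∣x) n∣gen = ∣⇒¬0<y<n (∣-trans n∣gen gen∣x) 0<x x<n

  proper⇒gen≢1 : ∀ {n} (I : Ideal n) → ProperIdeal n I → gen I ≢ 1
  proper⇒gen≢1 I (x , _ , gen∤x) gen≡1 = gen∤x (subst (_∣ x) (sym gen≡1) (1∣ x))

  InSum-∣ : ∀ {n g y} (I K : Ideal n) → g ∣ gen I → g ∣ gen K → g ∣ n → InSum n I K y → g ∣ y
  InSum-∣ {n} {g} {y} I K g∣I g∣K g∣n (_ , a , b , t , _ , _ , I∣a , K∣b , a+b≡y+tn) =
    ∣m+n∣m⇒∣n (subst (g ∣_) (trans a+b≡y+tn (+-comm y (t * n)))
                         (∣m∣n⇒∣m+n (∣-trans g∣I I∣a) (∣-trans g∣K K∣b)))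
              (∣-trans g∣n (n∣m*n t))

  ∣⇒InSum : ∀ {n y} (I K : Ideal n) → 0 < n → y < n → gen I ∣ y ⊎ gen K ∣ y → InSum n I K y
  ∣⇒InSum     I K 0<n y<n (inj₁ I∣y) = y<n , _ , 0 , 0 , y<n , 0<n , I∣y , (gen K ∣0) , refl
  ∣⇒InSum {y = y} I K 0<n y<n (inj₂ K∣y) = y<n , 0 , y , 0 , 0<n , y<n , (gen I ∣0) , K∣y , sym (+-identityʳ y)

  not-essential : ∀ {n g} (I K J : Ideal n) → NonzeroIdeal n J → g ∣ gen I → g ∣ gen K → g ∣ n →
                  (∀ {y} → g ∣ y → gen J ∣ y → n ∣ y) → ¬ SumEssential n I K
  not-essential I K J nzJ g∣I g∣K g∣n lcm ess with ess J nzJ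
  ... | y , 0<y , y∈I+K , J∣y = ∣⇒¬0<y<n (lcm (InSum-∣ I K g∣I g∣K g∣n y∈I+K) J∣y) 0<y (proj₁ y∈I+K)

module EssentialIdealGraph {p q : ℕ} (p-prime : Prime p) (q-prime : Prime q) (p≢q : p ≢ q) (m₀ : ℕ) where

  open PrimePowers
  open DistinctPrimes p-prime q-prime p≢q
  open Ideals
  open Counting
  open import Data.Nat using (_*_; _^_; _≤_; _<_; _∸_; z≤n; s≤s; _≟_)
  open import Data.Nat.Properties using (≤-refl; <⇒≤; n<1+n; ≤∧≢⇒<; <-irrefl)
  open import Data.Nat.Divisibility
  open import Data.Empty using (⊥; ⊥-elim)
  open import Data.Fin using (toℕ; fromℕ<)
  open import Data.Fin.Properties
    using (suc-injective; toℕ-injective; toℕ<n; toℕ-fromℕ<; combine-injective; remQuot-combine; combine-remQuot)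
  open import Data.Product using (∃; _,_; proj₁; proj₂)
  open import Data.Sum using (_⊎_; inj₁; inj₂)
  open import Function using (_∘_)
  open import Data.Bool using (true)
  open import Relation.Binary.PropositionalEquality
  open import Relation.Nullary using (¬_; yes; no)
  open import Relation.Nullary.Decidable using (dec-true)

  m n n/p n/q : ℕ
  m   = suc m₀
  n   = p ^ m * q ^ m
  n/p = p ^ m₀ * q ^ m
  n/q = p ^ m * q ^ m₀

  0<n : 0 < n
  0<n = p^a*q^b>0 m m

  n/p<n : n/p < n
  n/p<n = p^a*q^b<p^m*q^m (<⇒≤ (n<1+n m₀)) ≤-refl (inj₁ (n<1+n m₀))

  n/q<n : n/q < n
  n/q<n = p^a*q^b<p^m*q^m ≤-refl (<⇒≤ (n<1+n m₀)) (inj₂ (n<1+n m₀))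

  n/p∣n : n/p ∣ n
  n/p∣n = p^a*q^b∣p^a′*q^b′ {m₀} {m} {m} {m} (<⇒≤ (n<1+n m₀)) ≤-refl

  n/q∣n : n/q ∣ n
  n/q∣n = p^a*q^b∣p^a′*q^b′ {m} {m₀} {m} {m} ≤-refl (<⇒≤ (n<1+n m₀))

  ∣n/p : ∀ {a b} → a < m → b ≤ m → p ^ a * q ^ b ∣ n/p
  ∣n/p (s≤s a≤m₀) b≤m = p^a*q^b∣p^a′*q^b′ a≤m₀ b≤m

  ∣n/q : ∀ {a b} → a ≤ m → b < m → p ^ a * q ^ b ∣ n/q
  ∣n/q a≤m (s≤s b≤m₀) = p^a*q^b∣p^a′*q^b′ a≤m b≤m₀

  nonzero⇒∣n/p⊎∣n/q : (J : Ideal n) → NonzeroIdeal n J → gen J ∣ n/p ⊎ gen J ∣ n/q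
  nonzero⇒∣n/p⊎∣n/q J nzJ with ∣p^a*q^b⇒≡p^a′*q^b′ m m (proj₂ J)
  ... | a , b , a≤m , b≤m , gen≡ with <⊎< a≤m b≤m (λ { refl refl → nonzero⇒¬n∣gen J nzJ (∣-reflexive (sym gen≡)) })
  ... | inj₁ a<m = inj₁ (subst (_∣ n/p) (sym gen≡) (∣n/p a<m b≤m))
  ... | inj₂ b<m = inj₂ (subst (_∣ n/q) (sym gen≡) (∣n/q a≤m b<m))

  sum-essential : (I K : Ideal n) → gen I ∣ n/p ⊎ gen K ∣ n/p → gen I ∣ n/q ⊎ gen K ∣ n/q → SumEssential n I K
  sum-essential I K n/p∈I+K n/q∈I+K J nzJ with nonzero⇒∣n/p⊎∣n/q J nzJ
  ... | inj₁ J∣n/p = n/p , p^a*q^b>0 m₀ m , ∣⇒InSum I K 0<n n/p<n n/p∈I+K , J∣n/p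
  ... | inj₂ J∣n/q = n/q , p^a*q^b>0 m m₀ , ∣⇒InSum I K 0<n n/q<n n/q∈I+K , J∣n/q

  not-essential-p : (I K : Ideal n) → p ^ m ∣ gen I → p ^ m ∣ gen K → ¬ SumEssential n I K
  not-essential-p I K p^m∣I p^m∣K =
    not-essential I K (n/p , n/p∣n) (n/p , p^a*q^b>0 m₀ m , n/p<n , ∣-refl)
      p^m∣I p^m∣K (m∣m*n (q ^ m))
      (λ p^m∣y n/p∣y → p^a∣y⇒q^b∣y⇒p^a*q^b∣y m m p^m∣y (∣-trans (n∣m*n (p ^ m₀)) n/p∣y))

  not-essential-q : (I K : Ideal n) → q ^ m ∣ gen I → q ^ m ∣ gen K → ¬ SumEssential n I K
  not-essential-q I K q^m∣I q^m∣K =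
    not-essential I K (n/q , n/q∣n) (n/q , p^a*q^b>0 m m₀ , n/q<n , ∣-refl)
      q^m∣I q^m∣K (n∣m*n (p ^ m))
      (λ q^m∣y n/q∣y → p^a∣y⇒q^b∣y⇒p^a*q^b∣y m m (∣-trans (m∣m*n {p ^ m} (q ^ m₀)) n/q∣y) q^m∣y)

  -- (a, b) ≠ (m, m) as the ideal is nonzero, and (a, b) ≠ (0, 0) as it is proper.
  record VertexExponents : Set where
    field
      a b     : ℕ
      a≤m     : a ≤ m
      b≤m     : b ≤ m
      notTop    : a < m ⊎ b < m
      notBottom : 0 < a ⊎ 0 < b
  open VertexExponents

  generator : VertexExponents → ℕ
  generator e = p ^ a e * q ^ b e

  classOfExponents : ℕ → ℕ → Class
  classOfExponents a b with a ≟ m | b ≟ m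
  ... | yes _ | _     = pFull
  ... | no _  | yes _ = qFull
  ... | no _  | no _  = interior

  classOf : VertexExponents → Class
  classOf e = classOfExponents (a e) (b e)

  data ClassView (e : VertexExponents) : Class → Set where
    viewP : a e ≡ m → b e < m → ClassView e pFull
    viewQ : a e < m → b e ≡ m → ClassView e qFull
    viewI : a e < m → b e < m → ClassView e interior

  classView : ∀ e → ClassView e (classOf e)
  classView e with a e ≟ m | b e ≟ m | notTop e
  ... | yes a≡m | _       | inj₁ a<m = ⊥-elim (<-irrefl a≡m a<m)
  ... | yes a≡m | _       | inj₂ b<m = viewP a≡m b<m
  ... | no a≢m  | yes b≡m | _        = viewQ (≤∧≢⇒< (a≤m e) a≢m) b≡m
  ... | no a≢m  | no b≢m  | _        = viewI (≤∧≢⇒< (a≤m e) a≢m) (≤∧≢⇒< (b≤m e) b≢m)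

  data GeneratorView (d : ℕ) : Class → Set where
    viewP : p ^ m ∣ d → d ∣ n/q → GeneratorView d pFull
    viewQ : d ∣ n/p → q ^ m ∣ d → GeneratorView d qFull
    viewI : d ∣ n/p → d ∣ n/q → GeneratorView d interior

  generatorView : ∀ e → GeneratorView (generator e) (classOf e)
  generatorView e with classOf e | classView e
  ... | _ | viewP a≡m b<m = viewP (subst (λ a → p ^ m ∣ p ^ a * q ^ b e) (sym a≡m) (m∣m*n (q ^ b e))) (∣n/q (a≤m e) b<m)
  ... | _ | viewQ a<m b≡m = viewQ (∣n/p a<m (b≤m e)) (subst (λ b → q ^ m ∣ p ^ a e * q ^ b) (sym b≡m) (n∣m*n (p ^ a e)))
  ... | _ | viewI a<m b<m = viewI (∣n/p a<m (b≤m e)) (∣n/q (a≤m e) b<m)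

  classOf-pFull : ∀ e → a e ≡ m → classOf e ≡ pFull
  classOf-pFull e a≡m with classOf e | classView e
  ... | _ | viewP _ _   = refl
  ... | _ | viewQ a<m _ = ⊥-elim (<-irrefl a≡m a<m)
  ... | _ | viewI a<m _ = ⊥-elim (<-irrefl a≡m a<m)

  classOf-qFull : ∀ e → a e < m → b e ≡ m → classOf e ≡ qFull
  classOf-qFull e a<m b≡m with classOf e | classView e
  ... | _ | viewP a≡m _ = ⊥-elim (<-irrefl a≡m a<m)
  ... | _ | viewQ _ _   = refl
  ... | _ | viewI _ b<m = ⊥-elim (<-irrefl b≡m b<m)

  classOf-interior : ∀ e → a e < m → b e < m → classOf e ≡ interior
  classOf-interior e a<m b<m with classOf e | classView e
  ... | _ | viewP a≡m _ = ⊥-elim (<-irrefl a≡m a<m)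
  ... | _ | viewQ _ b≡m = ⊥-elim (<-irrefl b≡m b<m)
  ... | _ | viewI _ _   = refl

  exponents : (I : Ideal n) → NonzeroIdeal n I → ProperIdeal n I → ∃ λ e → gen I ≡ generator e
  exponents I nzI prI with ∣p^a*q^b⇒≡p^a′*q^b′ m m (proj₂ I)
  ... | a , b , a≤m , b≤m , gen≡ = e , gen≡
    where
    top : a ≡ m → b ≡ m → ⊥
    top refl refl = nonzero⇒¬n∣gen I nzI (∣-reflexive (sym gen≡))
    bottom : a ≡ 0 → b ≡ 0 → ⊥
    bottom refl refl = proper⇒gen≢1 I prI gen≡
    e : VertexExponents
    e = record
      { a = a ; b = b ; a≤m = a≤m ; b≤m = b≤m
      ; notTop = <⊎< a≤m b≤m top ; notBottom = 0<⊎0< a b bottom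
      }

  generator<n : ∀ e → generator e < n
  generator<n e = p^a*q^b<p^m*q^m (a≤m e) (b≤m e) (notTop e)

  ¬bottom : ∀ e → a e ≡ 0 → b e ≡ 0 → ⊥
  ¬bottom e a≡0 b≡0 with notBottom e
  ... | inj₁ 0<a = <-irrefl (sym a≡0) 0<a
  ... | inj₂ 0<b = <-irrefl (sym b≡0) 0<b

  generator≢1 : ∀ e → generator e ≢ 1
  generator≢1 e gen≡1 = let (a≡0 , b≡0) = p^a*q^b≡1⇒ (a e) (b e) gen≡1 in ¬bottom e a≡0 b≡0

  module Vertices {N : ℕ} (E : VertexEnum n N) where

    open VertexEnum E

    exponentsOf : Fin N → VertexExponents
    exponentsOf i = proj₁ (exponents (vtx i) (nonzero i) (proper i))

    gen-exponentsOf : ∀ i → gen (vtx i) ≡ generator (exponentsOf i)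
    gen-exponentsOf i = proj₂ (exponents (vtx i) (nonzero i) (proper i))

    vertex : ∀ e → ∃ λ i → gen (vtx i) ≡ generator e
    vertex e = complete (generator e , p^a*q^b∣p^a′*q^b′ (a≤m e) (b≤m e))
      (generator e , p^a*q^b>0 (a e) (b e) , generator<n e , ∣-refl)
      (1 , p^a*q^b<p^m*q^m {0} {0} {m} z≤n z≤n (inj₁ (s≤s z≤n)) , generator≢1 e ∘ ∣1⇒≡1)

    vertexAt : VertexExponents → Fin N
    vertexAt = proj₁ ∘ vertex

    class : Fin N → Class
    class = classOf ∘ exponentsOf

    vertexView : ∀ i → GeneratorView (gen (vtx i)) (class i)
    vertexView i = subst (λ d → GeneratorView d (class i)) (sym (gen-exponentsOf i)) (generatorView (exponentsOf i))

    adjacency : ∀ {A} → IsAdjacencyMatrix n N E A → ∀ i j → i ≢ j → A i j ≡ classAdj (class i) (class j)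
    adjacency {A} isAdj i j i≢j = entry (vertexView i) (vertexView j)
      where
      adjacent : gen (vtx i) ∣ n/p ⊎ gen (vtx j) ∣ n/p → gen (vtx i) ∣ n/q ⊎ gen (vtx j) ∣ n/q → A i j ≡ + 1
      adjacent n/p∈ n/q∈ = proj₁ (proj₂ (isAdj i j)) i≢j (sum-essential (vtx i) (vtx j) n/p∈ n/q∈)
      nonadjacent : ¬ SumEssential n (vtx i) (vtx j) → A i j ≡ + 0
      nonadjacent = proj₂ (proj₂ (isAdj i j)) i≢j
      entry : ∀ {s s′} → GeneratorView (gen (vtx i)) s → GeneratorView (gen (vtx j)) s′ → A i j ≡ classAdj s s′
      entry (viewP pᵢ _)  (viewP pⱼ _)  = nonadjacent (not-essential-p (vtx i) (vtx j) pᵢ pⱼ)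
      entry (viewQ _ qᵢ)  (viewQ _ qⱼ)  = nonadjacent (not-essential-q (vtx i) (vtx j) qᵢ qⱼ)
      entry (viewI pᵢ qᵢ) _             = adjacent (inj₁ pᵢ) (inj₁ qᵢ)
      entry (viewP _ qᵢ)  (viewI pⱼ _)  = adjacent (inj₂ pⱼ) (inj₁ qᵢ)
      entry (viewP _ qᵢ)  (viewQ pⱼ _)  = adjacent (inj₂ pⱼ) (inj₁ qᵢ)
      entry (viewQ pᵢ _)  (viewI _ qⱼ)  = adjacent (inj₁ pᵢ) (inj₂ qⱼ)
      entry (viewQ pᵢ _)  (viewP _ qⱼ)  = adjacent (inj₁ pᵢ) (inj₂ qⱼ)

    class-vertexAt : ∀ e → class (vertexAt e) ≡ classOf e
    class-vertexAt e with p^a*q^b-injective (trans (sym (gen-exponentsOf (vertexAt e))) (proj₂ (vertex e)))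
    ... | a≡ , b≡ = cong₂ classOfExponents a≡ b≡

    classCount-enumeration : ∀ s K (f : Fin K → VertexExponents) →
      (∀ k k′ → generator (f k) ≡ generator (f k′) → k ≡ k′) →
      (∀ k → classOf (f k) ≡ s) →
      (∀ e → classOf e ≡ s → ∃ λ k → generator (f k) ≡ generator e) →
      classCount class s ≡ K
    classCount-enumeration s K f f-injective f-class f-onto =
      count-image _ (vertexAt ∘ f) injective′
        (λ k → dec-true (class (vertexAt (f k)) Fin.≟ s) (trans (class-vertexAt (f k)) (f-class k))) onto
      where
      injective′ : ∀ k k′ → vertexAt (f k) ≡ vertexAt (f k′) → k ≡ k′
      injective′ k k′ eq =
        f-injective k k′ (trans (sym (proj₂ (vertex (f k)))) (trans (cong (gen ∘ vtx) eq) (proj₂ (vertex (f k′)))))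
      onto : ∀ i → does (class i Fin.≟ s) ≡ true → ∃ λ k → vertexAt (f k) ≡ i
      onto i cls with class i Fin.≟ s | cls
      ... | yes clsᵢ≡s | _ with f-onto (exponentsOf i) clsᵢ≡s
      ...   | k , gen≡ = k , injective (vertexAt (f k)) i (trans (proj₂ (vertex (f k))) (trans gen≡ (sym (gen-exponentsOf i))))

    classCount-pFull : classCount class pFull ≡ m
    classCount-pFull = classCount-enumeration pFull m f injective′ (λ k → classOf-pFull (f k) refl) onto
      where
      f : Fin m → VertexExponents
      f k = record { a = m ; b = toℕ k ; a≤m = ≤-refl ; b≤m = <⇒≤ (toℕ<n k)
                   ; notTop = inj₂ (toℕ<n k) ; notBottom = inj₁ (s≤s z≤n) }
      injective′ : ∀ k k′ → generator (f k) ≡ generator (f k′) → k ≡ k′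
      injective′ k k′ = toℕ-injective ∘ proj₂ ∘ p^a*q^b-injective {m} {toℕ k} {m} {toℕ k′}
      onto : ∀ e → classOf e ≡ pFull → ∃ λ k → generator (f k) ≡ generator e
      onto e cls with classOf e | classView e | cls
      ... | _ | viewP a≡m b<m | _ = fromℕ< b<m , cong₂ (λ x y → p ^ x * q ^ y) (sym a≡m) (toℕ-fromℕ< b<m)

    classCount-qFull : classCount class qFull ≡ m
    classCount-qFull = classCount-enumeration qFull m f injective′ (λ k → classOf-qFull (f k) (toℕ<n k) refl) onto
      where
      f : Fin m → VertexExponents
      f k = record { a = toℕ k ; b = m ; a≤m = <⇒≤ (toℕ<n k) ; b≤m = ≤-refl
                   ; notTop = inj₁ (toℕ<n k) ; notBottom = inj₂ (s≤s z≤n) }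
      injective′ : ∀ k k′ → generator (f k) ≡ generator (f k′) → k ≡ k′
      injective′ k k′ = toℕ-injective ∘ proj₁ ∘ p^a*q^b-injective {toℕ k} {m} {toℕ k′} {m}
      onto : ∀ e → classOf e ≡ qFull → ∃ λ k → generator (f k) ≡ generator e
      onto e cls with classOf e | classView e | cls
      ... | _ | viewQ a<m b≡m | _ = fromℕ< a<m , cong₂ (λ x y → p ^ x * q ^ y) (toℕ-fromℕ< a<m) (sym b≡m)

    -- The nonzero elements of Fin (m * m) enumerate the exponent pairs below m other than (0, 0).
    classCount-interior : classCount class interior ≡ m * m ∸ 1
    classCount-interior = classCount-enumeration interior (m * m ∸ 1) f injective′
                            (λ j → classOf-interior (f j) (toℕ<n (x j)) (toℕ<n (y j))) onto
      where
      x y : Fin (m * m ∸ 1) → Fin m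
      x j = proj₁ (Fin.remQuot {m} m (Fin.suc j))
      y j = proj₂ (Fin.remQuot {m} m (Fin.suc j))
      combine-xy : ∀ j → Fin.combine (x j) (y j) ≡ Fin.suc j
      combine-xy j = combine-remQuot {m} m (Fin.suc j)
      xy≢00 : ∀ j → toℕ (x j) ≡ 0 → toℕ (y j) ≡ 0 → ⊥
      xy≢00 j x≡0 y≡0
        with trans (sym (combine-xy j)) (cong₂ Fin.combine (toℕ-injective {j = Fin.zero} x≡0) (toℕ-injective {j = Fin.zero} y≡0))
      ... | ()
      f : Fin (m * m ∸ 1) → VertexExponents
      f j = record
        { a = toℕ (x j) ; b = toℕ (y j) ; a≤m = <⇒≤ (toℕ<n (x j)) ; b≤m = <⇒≤ (toℕ<n (y j))
        ; notTop = inj₁ (toℕ<n (x j)) ; notBottom = 0<⊎0< (toℕ (x j)) (toℕ (y j)) (xy≢00 j)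
        }
      injective′ : ∀ j j′ → generator (f j) ≡ generator (f j′) → j ≡ j′
      injective′ j j′ eq with p^a*q^b-injective {toℕ (x j)} {toℕ (y j)} {toℕ (x j′)} {toℕ (y j′)} eq
      ... | x≡ , y≡ = suc-injective
            (trans (sym (combine-xy j)) (trans (cong₂ Fin.combine (toℕ-injective x≡) (toℕ-injective y≡)) (combine-xy j′)))
      onto : ∀ e → classOf e ≡ interior → ∃ λ j → generator (f j) ≡ generator e
      onto e cls with classOf e | classView e | cls
      ... | _ | viewI a<m b<m | _ with Fin.combine (fromℕ< a<m) (fromℕ< b<m) in c≡
      ...   | Fin.zero with combine-injective (fromℕ< a<m) (fromℕ< b<m) Fin.zero Fin.zero c≡
      ...     | a≡0 , b≡0 =
        ⊥-elim (¬bottom e (trans (sym (toℕ-fromℕ< a<m)) (cong toℕ a≡0)) (trans (sym (toℕ-fromℕ< b<m)) (cong toℕ b≡0)))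
      onto e cls | _ | viewI a<m b<m | _ | Fin.suc j = j , cong₂ (λ u v → p ^ u * q ^ v)
          (trans (cong (toℕ ∘ proj₁) xy≡) (toℕ-fromℕ< a<m)) (trans (cong (toℕ ∘ proj₂) xy≡) (toℕ-fromℕ< b<m))
        where
        xy≡ : Fin.remQuot {m} m (Fin.suc j) ≡ (fromℕ< a<m , fromℕ< b<m)
        xy≡ = trans (cong (Fin.remQuot m) (sym c≡)) (remQuot-combine _ _)

open Determinant
open ClassMatrix using (expansion-without-pure-rows)
open import Data.Bool using (if_then_else_)
open import Data.Integer using (_+_; _*_; -_; _-_; _^_; 0ℤ; 1ℤ)
open import Data.Integer.Properties using (pos-*; pos-+; ⊖-≥; m-n≡m⊖n; ^-distribˡ-+-*; +-identityʳ; +-identityˡ)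
open import Data.Integer.Tactic.RingSolver using (solve-∀)
open import Data.Nat using (z≤n; s≤s)
import Data.Nat.Properties as ℕᵖ
open import Data.Product using (proj₁)
open import Function using (const)
open import Relation.Binary.PropositionalEquality
open import Relation.Nullary using (yes; no)
open import Relation.Nullary.Decidable using (dec-true; dec-false)
open ≡-Reasoning

charMatrix : ∀ {N} → Matrix N → ℤ → Matrix N
charMatrix A x i j = (if does (i Fin.≟ j) then x else 0ℤ) - A i j

-- The entries of x I − A in charPolyAt come from a where-bound function of Defs, which cannot be
-- named: the hole in the type of charPolyAt-entry is solved by its use in charPolyAt≡det.
mutual
  charPolyAt≡det : ∀ N (A : Matrix N) x → charPolyAt N A x ≡ det N (charMatrix A x)
  charPolyAt≡det N A x = det-cong N (charPolyAt-entry A x)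

  charPolyAt-entry : ∀ {N} (A : Matrix N) x i j → _ ≡ charMatrix A x i j
  charPolyAt-entry A x i j with i Fin.≟ j
  ... | yes _ = refl
  ... | no _  = refl

diagonalShift : ℤ → Class → ℤ
diagonalShift x interior = x + 1ℤ
diagonalShift x pFull    = x
diagonalShift x qFull    = x

diagonalShift-classAdj : ∀ x s → diagonalShift x s - classAdj s s ≡ x
diagonalShift-classAdj x interior = lemma x
  where
  lemma : ∀ x → x + 1ℤ - 1ℤ ≡ x
  lemma = solve-∀
diagonalShift-classAdj x pFull = +-identityʳ x
diagonalShift-classAdj x qFull = +-identityʳ x

vertexCounts : ℕ → Class → ℕ
vertexCounts m interior = m ℕ.* m ℕ.∸ 1
vertexCounts m pFull    = m
vertexCounts m qFull    = m

pos-∸ : ∀ {a b} → b ℕ.≤ a → + (a ℕ.∸ b) ≡ + a - + b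
pos-∸ {a} {b} b≤a = sym (trans (m-n≡m⊖n a b) (⊖-≥ b≤a))

pos-^ : ∀ a k → + (a ℕ.^ k) ≡ (+ a) ^ k
pos-^ a zero    = refl
pos-^ a (suc k) = trans (pos-* a (a ℕ.^ k)) (cong (+ a *_) (pos-^ a k))

expansion-vertexCounts : ∀ x k → let m = suc (suc k) in
  ClassMatrix.expansion (diagonalShift x) (vertexCounts m) (const 0)
  ≡ x ^ (2 ℕ.* m ℕ.∸ 2) * (x + 1ℤ) ^ (m ℕ.* m ℕ.∸ 2) * (x + + m)
    * (x * x - + (m ℕ.* m ℕ.+ m ℕ.∸ 2) * x - + (m ℕ.^ 3))
expansion-vertexCounts x k = begin
  ClassMatrix.expansion (diagonalShift x) (vertexCounts m) (const 0)
    ≡⟨ expansion-without-pure-rows (diagonalShift x) (vertexCounts m) ⟩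
  terms (+ (m ℕ.* m ℕ.∸ 1))                                          ≡⟨ cong terms m²-1 ⟩
  terms (μ * μ - 1ℤ)                                                 ≡⟨ factorise x X Y μ ⟩
  X * X * Y * (x + μ) * (x * x - (μ * μ + μ - + 2) * x - μ ^ 3)
    ≡⟨ cong₂ (λ u κ → u * Y * (x + μ) * (x * x - κ * x - μ ^ 3)) x^[2m-2] m²+m-2 ⟨
  x ^ (2 ℕ.* m ℕ.∸ 2) * Y * (x + μ) * (x * x - + (m ℕ.* m ℕ.+ m ℕ.∸ 2) * x - μ ^ 3)
    ≡⟨ cong (λ c → x ^ (2 ℕ.* m ℕ.∸ 2) * Y * (x + μ) * (x * x - + (m ℕ.* m ℕ.+ m ℕ.∸ 2) * x - c)) (pos-^ m 3) ⟨
  x ^ (2 ℕ.* m ℕ.∸ 2) * Y * (x + μ) * (x * x - + (m ℕ.* m ℕ.+ m ℕ.∸ 2) * x - + (m ℕ.^ 3)) ∎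
  where
  m : ℕ
  m = suc (suc k)
  μ X Y : ℤ
  μ = + m
  X = x ^ suc k
  Y = (x + 1ℤ) ^ (m ℕ.* m ℕ.∸ 2)
  -- With m = k + 2 the counts m * m ∸ 1 and m are successors, so the weights reduce
  -- definitionally to (x + 1) Y, (m² − 1) Y, x X and μ X.
  terms : ℤ → ℤ
  terms α = (x + 1ℤ) * Y * (x * X) * (x * X) - α * Y * (x * X) * (x * X) - α * Y * (μ * X) * (x * X)
            - α * Y * (x * X) * (μ * X) - (x + 1ℤ) * Y * (μ * X) * (μ * X) - α * Y * (μ * X) * (μ * X)
  m²-1 : + (m ℕ.* m ℕ.∸ 1) ≡ μ * μ - 1ℤ
  m²-1 = trans (pos-∸ {m ℕ.* m} (s≤s z≤n)) (cong (_- 1ℤ) (pos-* m m))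
  m²+m-2 : + (m ℕ.* m ℕ.+ m ℕ.∸ 2) ≡ μ * μ + μ - + 2
  m²+m-2 = trans (pos-∸ {m ℕ.* m ℕ.+ m} (s≤s (s≤s z≤n)))
                 (cong (_- + 2) (trans (pos-+ (m ℕ.* m) m) (cong (_+ μ) (pos-* m m))))
  x^[2m-2] : x ^ (2 ℕ.* m ℕ.∸ 2) ≡ X * X
  x^[2m-2] = trans (cong (x ^_) (trans (ℕᵖ.+-suc k (suc (k ℕ.+ 0))) (cong (λ j → suc (k ℕ.+ suc j)) (ℕᵖ.+-identityʳ k))))
                   (^-distribˡ-+-* x (suc k) (suc k))
  factorise : ∀ x X Y μ →
    (x + 1ℤ) * Y * (x * X) * (x * X) - (μ * μ - 1ℤ) * Y * (x * X) * (x * X) - (μ * μ - 1ℤ) * Y * (μ * X) * (x * X)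
      - (μ * μ - 1ℤ) * Y * (x * X) * (μ * X) - (x + 1ℤ) * Y * (μ * X) * (μ * X) - (μ * μ - 1ℤ) * Y * (μ * X) * (μ * X)
    ≡ X * X * Y * (x + μ) * (x * x - (μ * μ + μ - + 2) * x - μ * (μ * (μ * 1ℤ)))
  factorise = solve-∀

mainTheorem5 : (p q m : ℕ) → Prime p → Prime q → p ≢ q → 1 < m →
    let n = p ℕ.^ m ℕ.* q ℕ.^ m
        k = + (m ℕ.* m ℕ.+ m ℕ.∸ 2)
    in (N : ℕ) (E : VertexEnum n N) (A : Matrix N) → IsAdjacencyMatrix n N E A →
       (x : ℤ) →
       charPolyAt N A x
         ≡ (x ℤ.^ (2 ℕ.* m ℕ.∸ 2)) ℤ.* ((x ℤ.+ + 1) ℤ.^ (m ℕ.* m ℕ.∸ 2))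
             ℤ.* (x ℤ.+ + m) ℤ.* (x ℤ.* x ℤ.- k ℤ.* x ℤ.- + (m ℕ.^ 3))
mainTheorem5 p q (suc (suc k)) p-prime q-prime p≢q (s≤s (s≤s z≤n)) N E A isAdj x = begin
  charPolyAt N A x                                   ≡⟨ charPolyAt≡det N A x ⟩
  det N (charMatrix A x)                             ≡⟨ det-classMatrix N class (charMatrix A x) diagonal offDiagonal ⟩
  expansion (classCount class) (const 0)             ≡⟨ expansion-cong {C = const 0} {C′ = const 0} counts (λ _ → refl) ⟩
  expansion (vertexCounts (suc (suc k))) (const 0)   ≡⟨ expansion-vertexCounts x k ⟩
  _                                                  ∎
  where
  open EssentialIdealGraph p-prime q-prime p≢q (suc k)
  open Vertices E
  open ClassMatrix (diagonalShift x)
  diagonal : ∀ i → charMatrix A x i i ≡ diagonalShift x (class i) - classAdj (class i) (class i)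
  diagonal i = begin
    (if does (i Fin.≟ i) then x else 0ℤ) - A i i
      ≡⟨ cong₂ (λ b a → (if b then x else 0ℤ) - a) (dec-true (i Fin.≟ i) refl) (proj₁ (isAdj i i) refl) ⟩
    x - 0ℤ                                   ≡⟨ +-identityʳ x ⟩
    x                                        ≡⟨ diagonalShift-classAdj x (class i) ⟨
    diagonalShift x (class i) - classAdj (class i) (class i) ∎
  offDiagonal : ∀ i j → i ≢ j → charMatrix A x i j ≡ - classAdj (class i) (class j)
  offDiagonal i j i≢j = begin
    (if does (i Fin.≟ j) then x else 0ℤ) - A i j
      ≡⟨ cong₂ (λ b a → (if b then x else 0ℤ) - a) (dec-false (i Fin.≟ j) i≢j) (adjacency isAdj i j i≢j) ⟩
    0ℤ - classAdj (class i) (class j)        ≡⟨ +-identityˡ _ ⟩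
    - classAdj (class i) (class j)           ∎
  counts : ∀ s → classCount class s ≡ vertexCounts (suc (suc k)) s
  counts interior = classCount-interior
  counts pFull    = classCount-pFull
  counts qFull    = classCount-qFull
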